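{- Let $\nu,\mu,\gamma$ be partitions with $\ell(\nu)=n$, $\ell(\mu)=r$ and $\ell(\gamma)=m$. Then \[ \sum_{I=(i_1,\dots,i_m)\in\{0,\dots,n\}^m}\ \sum_{E\in E^{I}_n} (-t)^{|I|}\, B_{\mu,\,\gamma+I}\, B_{\nu-E} \;=\; \sum_{I=(i_1,\dots,i_r)\in\{0,\dots,m\}^r}\ \sum_{E\in E^{I}_m} (-t)^{|I|}\, B_{\mu+I}\, B_{\gamma-E,\,\nu}. \]
   Context: For $n\in\mathbb Z$, $B_n=\sum_{j\ge0}s_{j+n}[X]\,s_j[X(t-1)]^\perp$ acting on symmetric functions over $\mathbb Q(q,t)$ ($f^\perp$ adjoint to multiplication by $f$ for the Hall scalar product; $s_j[X(t-1)]$ the plethystic substitution $p_n\mapsto(t^n-1)p_n$). For $v\in\mathbb Z^L$, $B_v=\prod_{1\le a<b\le L}(1-te_{ab})B_{v_1}\cdots B_{v_L}$ with $e_{ab}$ raising the $a$-th index by one and lowering the $b$-th by one. $|I|=i_1+i_2+\cdots$. $E^d_p$ is the set of $0/1$-vectors of length $p$ with exactly $d$ ones; for $I=(i_1,i_2,\dots)$, the sum over $E\in E^I_p$ means the sum over all tuples $(E_1,E_2,\dots)$ with $E_j\in E^{i_j}_p$, with $E=E_1+E_2+\cdots$. Vector sums/differences are componentwise; $(\alpha,\beta)$ denotes concatenation. -}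

module Defs where

open import Data.Nat as ℕ using (ℕ; zero; suc; _⊔_; _<_; _≥_)
open import Data.Integer as ℤ using (ℤ; +_; -[1+_])
open import Data.Rational as ℚ using (ℚ; 0ℚ; 1ℚ; _/_)
open import Data.Rational.Properties using () renaming (_≟_ to _≟ℚ_)
open import Data.List as List using (List; []; _∷_; _++_; map; concatMap; foldr; upTo; replicate; zipWith; length; filter)
open import Data.Nat.ListAction using (sum)
open import Data.List.Properties using (≡-dec)
open import Data.List.Relation.Unary.All using (All)
open import Data.List.Relation.Unary.Linked using (Linked)
open import Data.Product using (_×_; _,_)
open import Data.Bool using (Bool; true; false; if_then_else_)
open import Relation.Nullary using (Dec; yes; no; _×-dec_)
open import Relation.Nullary.Decidable using (does)
open import Relation.Binary.PropositionalEquality using (_≡_)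

-- Concrete model of symmetric functions with coefficients in ℚ[t]:
-- ℚ[t][p₁,p₂,…] (power-sum basis).  A monomial  t^a p₁^{e₁} p₂^{e₂} …
-- is stored as (a , e₁ ∷ e₂ ∷ …); trailing zero exponents are irrelevant.

Mono : Set
Mono = ℕ × List ℕ

Term : Set
Term = ℚ × Mono

Sym : Set
Sym = List Term

trim : List ℕ → List ℕ
trim [] = []
trim (x ∷ xs) with trim xs
... | [] = if does (x ℕ.≟ 0) then [] else x ∷ []
... | y ∷ ys = x ∷ y ∷ ys

sameMono : Mono → Mono → Bool
sameMono (a , xs) (b , ys) = does ((a ℕ.≟ b) ×-dec ≡-dec ℕ._≟_ (trim xs) (trim ys))

coeff : Sym → Mono → ℚ
coeff [] m = 0ℚ
coeff ((c , m′) ∷ f) m = (if sameMono m′ m then c else 0ℚ) ℚ.+ coeff f m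

infix 4 _≈_
_≈_ : Sym → Sym → Set
f ≈ g = ∀ m → coeff f m ≡ coeff g m

one : Sym
one = (1ℚ , (0 , [])) ∷ []

scale : ℚ → Sym → Sym
scale c = map (λ { (d , m) → (c ℚ.* d , m) })

neg : Sym → Sym
neg = scale (ℚ.- 1ℚ)

addL : List ℕ → List ℕ → List ℕ
addL [] ys = ys
addL (x ∷ xs) [] = x ∷ xs
addL (x ∷ xs) (y ∷ ys) = (x ℕ.+ y) ∷ addL xs ys

mulMono : Mono → Mono → Mono
mulMono (a , xs) (b , ys) = (a ℕ.+ b , addL xs ys)

mul : Sym → Sym → Sym
mul f g = concatMap (λ { (c , m) → map (λ { (d , n) → (c ℚ.* d , mulMono m n) }) g }) f

pow : Sym → ℕ → Sym
pow f zero = one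
pow f (suc k) = mul f (pow f k)

iter : {A : Set} → ℕ → (A → A) → A → A
iter zero h x = x
iter (suc k) h x = h (iter k h x)

tPow : ℕ → Sym
tPow a = (1ℚ , (a , [])) ∷ []

-- pS k = p_{k+1}
pS : ℕ → Sym
pS k = (1ℚ , (0 , replicate k 0 ++ (1 ∷ []))) ∷ []

-- ∂/∂p_{k+1} on one term (exponent vector)
derivL : ℕ → List ℕ → ℕ × List ℕ   -- (old exponent e, vector with e-1)
derivL zero [] = (0 , [])
derivL zero (zero ∷ xs) = (0 , zero ∷ xs)
derivL zero (suc e ∷ xs) = (suc e , e ∷ xs)
derivL (suc k) [] = (0 , [])
derivL (suc k) (x ∷ xs) with derivL k xs
... | (e , ys) = (e , x ∷ ys)

deriv : ℕ → Sym → Sym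
deriv k = concatMap (λ { (c , (a , xs)) → dterm c a (derivL k xs) })
  where
  dterm : ℚ → ℕ → ℕ × List ℕ → Sym
  dterm c a (zero , ys) = []
  dterm c a (suc e , ys) = (c ℚ.* ((+ suc e) / 1) , (a , ys)) ∷ []

-- p_{k+1}^⊥ = (k+1) ∂/∂p_{k+1}  (adjoint w.r.t. the Hall scalar product)
pperp : ℕ → Sym → Sym
pperp k g = scale ((+ suc k) / 1) (deriv k g)

perpExp : ℕ → List ℕ → Sym → Sym
perpExp k [] g = g
perpExp k (e ∷ es) g = iter e (pperp k) (perpExp (suc k) es g)

-- f^⊥ g  (Hall-adjoint of multiplication by f; bilinear over the scalars)
perp : Sym → Sym → Sym
perp f g = concatMap (λ { (c , (a , xs)) → mul ((c , (a , [])) ∷ []) (perpExp 0 xs g) }) f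

degL : ℕ → List ℕ → ℕ
degL k [] = 0
degL k (e ∷ es) = e ℕ.* suc k ℕ.+ degL (suc k) es

deg : Sym → ℕ
deg = foldr (λ { (c , (a , xs)) r → degL 0 xs ⊔ r }) 0

-- complete homogeneous h_j via Newton: j h_j = Σ_{k=1}^j p_k h_{j-k}
hsRev : ℕ → List Sym          -- [h_n , … , h_0]
hsRev zero = one ∷ []
hsRev (suc n) = new ∷ prev
  where
  prev = hsRev n
  go : ℕ → List Sym → Sym
  go i [] = []
  go i (h ∷ hs) = mul (pS i) h ++ go (suc i) hs
  new = scale ((+ 1) / suc n) (go 0 prev)

hd : List Sym → Sym
hd [] = []
hd (x ∷ _) = x

h : ℕ → Sym
h j = hd (hsRev j)

s : ℤ → Sym
s (+ j) = h j
s -[1+ _ ] = []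

-- plethystic substitution f ↦ f[X(t-1)] : p_k ↦ (t^k - 1) p_k
plethL : ℕ → List ℕ → Sym
plethL k [] = one
plethL k (e ∷ es) = mul (pow (mul (tPow (suc k) ++ neg one) (pS k)) e) (plethL (suc k) es)

pleth : Sym → Sym
pleth = concatMap (λ { (c , (a , xs)) → mul ((c , (a , [])) ∷ []) (plethL 0 xs) })

-- B_n = Σ_{j ≥ 0} s_{j+n}[X] s_j[X(t-1)]^⊥   (terms j > deg f vanish on f)
B : ℤ → Sym → Sym
B n f = concatMap (λ j → mul (s (n ℤ.+ + j)) (perp (pleth (s (+ j))) f)) (upTo (suc (deg f)))

-- B_v = Π_{a<b} (1 - t e_{ab}) B_{v₁} ⋯ B_{v_L}

modifyAt : ℕ → (ℤ → ℤ) → List ℤ → List ℤ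
modifyAt k g [] = []
modifyAt zero g (x ∷ xs) = g x ∷ xs
modifyAt (suc k) g (x ∷ xs) = x ∷ modifyAt k g xs

raise : ℕ → ℕ → List ℤ → List ℤ
raise a b v = modifyAt b (λ x → x ℤ.- + 1) (modifyAt a (λ x → x ℤ.+ + 1) v)

pairs : ℕ → List (ℕ × ℕ)
pairs L = concatMap (λ a → map (λ b → (a , b)) (filter (λ b → a ℕ.<? b) (upTo L))) (upTo L)

negT : Sym
negT = neg (tPow 1)

-- expansion of Π_{a<b}(1 - t e_{ab}) applied to the index vector v
expand : List ℤ → List (Sym × List ℤ)
expand v = foldr step ((one , v) ∷ []) (pairs (length v))
  where
  step : ℕ × ℕ → List (Sym × List ℤ) → List (Sym × List ℤ)
  step (a , b) = concatMap (λ { (c , w) → (c , w) ∷ (mul negT c , raise a b w) ∷ [] })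

applyAll : List ℤ → Sym → Sym
applyAll [] f = f
applyAll (x ∷ xs) f = B x (applyAll xs f)

Bv : List ℤ → Sym → Sym
Bv v f = concatMap (λ { (c , w) → mul c (applyAll w f) }) (expand v)

vecs : ℕ → ℕ → List (List ℕ)
vecs zero n = [] ∷ []
vecs (suc k) n = concatMap (λ i → map (i ∷_) (vecs k n)) (upTo (suc n))

bins : ℕ → List (List ℕ)
bins zero = [] ∷ []
bins (suc p) = concatMap (λ x → map (x ∷_) (bins p)) (0 ∷ 1 ∷ [])

Ed : ℕ → ℕ → List (List ℕ)
Ed d p = filter (λ e → sum e ℕ.≟ d) (bins p)

-- E^I_p : tuples (E₁, E₂, …) with E_j ∈ E^{i_j}_p
EI : List ℕ → ℕ → List (List (List ℕ))
EI [] p = [] ∷ []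
EI (i ∷ I) p = concatMap (λ e → map (e ∷_) (EI I p)) (Ed i p)

-- E = E₁ + E₂ + ⋯ (componentwise), length p
sumE : ℕ → List (List ℕ) → List ℕ
sumE p = foldr (zipWith ℕ._+_) (replicate p 0)

toZ : List ℕ → List ℤ
toZ = map +_

_⊕_ : List ℤ → List ℤ → List ℤ
_⊕_ = zipWith ℤ._+_

_⊖_ : List ℤ → List ℤ → List ℤ
_⊖_ = zipWith ℤ._-_

IsPartition : List ℕ → Set
IsPartition λs = Linked _≥_ λs × All (0 <_) λs

LHS : List ℕ → List ℕ → List ℕ → Sym → Sym
LHS ν μ γ f =
  concatMap (λ I → concatMap (λ Es →
      mul (pow negT (sum I))
          (Bv (toZ μ ++ (toZ γ ⊕ toZ I)) (Bv (toZ ν ⊖ toZ (sumE n Es)) f)))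
    (EI I n)) (vecs m n)
  where
  n = length ν
  m = length γ

RHS : List ℕ → List ℕ → List ℕ → Sym → Sym
RHS ν μ γ f =
  concatMap (λ I → concatMap (λ Es →
      mul (pow negT (sum I))
          (Bv (toZ μ ⊕ toZ I) (Bv ((toZ γ ⊖ toZ (sumE m Es)) ++ toZ ν) f)))
    (EI I m)) (vecs r m)
  where
  m = length γ
  r = length μ

-- Expanding every product Π(1 - t e_ab), both sides become formal sums of words (-t)^k B_w, namely
-- the single word B_{μ,γ,ν} hit by the raising operators 1 - t e_ab for some set of position pairs
-- a < b. On the left, the sum over I and E ∈ E^I_n is exactly the expansion of the factors with a in γ
-- and b in ν (E_a records the b's raised against a); with the pairs inside (μ,γ) and inside ν
-- these are all pairs except those in μ × ν. On the right, the pairs inside μ, inside (γ,ν) and in μ × γ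
-- give the same set. Raising operators commute, so the two formal sums agree up to order. Evaluating a formal sum needs B_n to be additive, and since B_n f only sums
-- the terms j ≤ deg f, this rests on s_j[X(t-1)]^⊥ killing everything of degree below j.

{-# OPTIONS --safe #-}
module Submission where

open import Defs
open import Data.Nat as ℕ using (ℕ; zero; suc; _+_; _*_; _≤_; _<_; _⊔_; z≤n; s≤s)
import Data.Nat.Properties as ℕP
open import Data.Nat.Solver using (module +-*-Solver)
open import Data.Nat.ListAction using (sum)
open import Data.Integer as ℤ using (ℤ; +_)
import Data.Integer.Properties as ℤP
open import Data.Rational as ℚ using (ℚ; _/_)
import Data.Rational.Properties as ℚP
open import Data.List using (List; []; _∷_; [_]; _++_; map; concat; concatMap; foldr; upTo; applyUpTo; length; replicate; zipWith; filter)
import Data.List.Properties as LP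
open import Data.List.Relation.Unary.All as All using (All; []; _∷_)
import Data.List.Relation.Unary.All.Properties as AllP
open import Data.List.Relation.Binary.Permutation.Propositional as ↭ using (_↭_; ↭-refl; ↭-sym; ↭-trans; ↭-reflexive; prep; swap)
import Data.List.Relation.Binary.Permutation.Propositional.Properties as ↭P
open import Data.Product using (_×_; _,_; proj₁; proj₂)
open import Data.Sum using (_⊎_; inj₁; inj₂)
open import Relation.Nullary using (yes; no)
open import Data.Unit using (⊤; tt)
open import Data.Bool using (if_then_else_)
open import Function using (_∘_; id)
open import Relation.Binary.PropositionalEquality using (_≡_; refl; sym; trans; cong; cong₂; subst; module ≡-Reasoning)

open +-*-Solver using (solve; _:=_; _:+_; _:*_; con)

module _ {A B : Set} where

  concatMap⁺ : (f : A → List B) {xs ys : List A} → xs ↭ ys → concatMap f xs ↭ concatMap f ys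
  concatMap⁺ f ↭.refl = ↭-refl
  concatMap⁺ f (prep x p) = ↭P.++⁺ˡ (f x) (concatMap⁺ f p)
  concatMap⁺ f (swap x y p) = ↭-trans (↭P.shifts (f x) (f y)) (↭P.++⁺ˡ (f y) (↭P.++⁺ˡ (f x) (concatMap⁺ f p)))
  concatMap⁺ f (↭.trans p q) = ↭-trans (concatMap⁺ f p) (concatMap⁺ f q)

  concatMap-cong-↭ : {f g : A → List B} (xs : List A) → (∀ x → f x ↭ g x) → concatMap f xs ↭ concatMap g xs
  concatMap-cong-↭ [] e = ↭-refl
  concatMap-cong-↭ (x ∷ xs) e = ↭P.++⁺ (e x) (concatMap-cong-↭ xs e)

  concatMap-cong-↭-local : {f g : A → List B} {xs : List A} → All (λ x → f x ↭ g x) xs → concatMap f xs ↭ concatMap g xs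
  concatMap-cong-↭-local [] = ↭-refl
  concatMap-cong-↭-local (p ∷ ps) = ↭P.++⁺ p (concatMap-cong-↭-local ps)

  concatMap-cong-local : {f g : A → List B} {xs : List A} → All (λ x → f x ≡ g x) xs → concatMap f xs ≡ concatMap g xs
  concatMap-cong-local ps = cong concat (LP.map-cong-local ps)

  concatMap-++-distrib : (f g : A → List B) (xs : List A) →
                         concatMap (λ x → f x ++ g x) xs ↭ concatMap f xs ++ concatMap g xs
  concatMap-++-distrib f g [] = ↭-refl
  concatMap-++-distrib f g (x ∷ xs) = begin
    (f x ++ g x) ++ concatMap (λ x → f x ++ g x) xs  ≡⟨ LP.++-assoc (f x) (g x) _ ⟩
    f x ++ g x ++ concatMap (λ x → f x ++ g x) xs    ↭⟨ ↭P.++⁺ˡ (f x) (↭P.++⁺ˡ (g x) (concatMap-++-distrib f g xs)) ⟩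
    f x ++ g x ++ concatMap f xs ++ concatMap g xs   ↭⟨ ↭P.++⁺ˡ (f x) (↭P.shifts (g x) (concatMap f xs)) ⟩
    f x ++ concatMap f xs ++ g x ++ concatMap g xs   ≡⟨ LP.++-assoc (f x) (concatMap f xs) _ ⟨
    (f x ++ concatMap f xs) ++ g x ++ concatMap g xs ∎
    where open ↭.PermutationReasoning

  concatMap-[] : (xs : List A) → concatMap {B = B} (λ _ → []) xs ≡ []
  concatMap-[] [] = refl
  concatMap-[] (x ∷ xs) = concatMap-[] xs

  concatMap-[_] : (f : A → B) (xs : List A) → concatMap (λ x → [ f x ]) xs ≡ map f xs
  concatMap-[ f ] [] = refl
  concatMap-[ f ] (x ∷ xs) = cong (f x ∷_) (concatMap-[ f ] xs)

module _ {A B C : Set} where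

  concatMap-concatMap : (f : B → List C) (g : A → List B) (xs : List A) →
                        concatMap f (concatMap g xs) ≡ concatMap (concatMap f ∘ g) xs
  concatMap-concatMap f g [] = refl
  concatMap-concatMap f g (x ∷ xs) =
    trans (LP.concatMap-++ f (g x) (concatMap g xs)) (cong (concatMap f (g x) ++_) (concatMap-concatMap f g xs))

  concatMap-comm : (F : A → B → List C) (xs : List A) (ys : List B) →
                   concatMap (λ x → concatMap (F x) ys) xs ↭ concatMap (λ y → concatMap (λ x → F x y) xs) ys
  concatMap-comm F [] ys = ↭-reflexive (sym (concatMap-[] ys))
  concatMap-comm F (x ∷ xs) ys =
    ↭-trans (↭P.++⁺ˡ (concatMap (F x) ys) (concatMap-comm F xs ys))
            (↭-sym (concatMap-++-distrib (F x) (λ y → concatMap (λ x → F x y) xs) ys))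

↭⇒≈ : {f g : Sym} → f ↭ g → f ≈ g
↭⇒≈ ↭.refl m = refl
↭⇒≈ (prep (c , m′) p) m = cong ((if sameMono m′ m then c else ℚ.0ℚ) ℚ.+_) (↭⇒≈ p m)
↭⇒≈ {f = _ ∷ _ ∷ f} (swap (c₁ , m₁) (c₂ , m₂) p) m = begin
  a₁ ℚ.+ (a₂ ℚ.+ coeff f m)  ≡⟨ ℚP.+-assoc a₁ a₂ _ ⟨
  (a₁ ℚ.+ a₂) ℚ.+ coeff f m  ≡⟨ cong (ℚ._+ coeff f m) (ℚP.+-comm a₁ a₂) ⟩
  (a₂ ℚ.+ a₁) ℚ.+ coeff f m  ≡⟨ ℚP.+-assoc a₂ a₁ _ ⟩
  a₂ ℚ.+ (a₁ ℚ.+ coeff f m)  ≡⟨ cong (λ z → a₂ ℚ.+ (a₁ ℚ.+ z)) (↭⇒≈ p m) ⟩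
  _                          ∎
  where
  open ≡-Reasoning
  a₁ = if sameMono m₁ m then c₁ else ℚ.0ℚ
  a₂ = if sameMono m₂ m then c₂ else ℚ.0ℚ
↭⇒≈ (↭.trans p q) m = trans (↭⇒≈ p m) (↭⇒≈ q m)

degree : Term → ℕ
degree (_ , (_ , es)) = degL 0 es

Homogeneous : ℕ → Sym → Set
Homogeneous d = All (λ u → degree u ≡ d)

DegreeBelow : ℕ → Sym → Set
DegreeBelow d = All (λ u → degree u < d)

degL-addL : ∀ k es fs → degL k (addL es fs) ≡ degL k es + degL k fs
degL-addL k [] fs = refl
degL-addL k (e ∷ es) [] = sym (ℕP.+-identityʳ _)
degL-addL k (e ∷ es) (f ∷ fs) rewrite degL-addL (suc k) es fs =
  solve 5 (λ e f k a b → (e :+ f) :* k :+ (a :+ b) := (e :* k :+ a) :+ (f :* k :+ b))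
        refl e f (suc k) (degL (suc k) es) (degL (suc k) fs)

mulTerm : Term → Term → Term
mulTerm (c , m) (d , n) = (c ℚ.* d , mulMono m n)

homogeneous-map-mulTerm : ∀ {a b} u {g} → degree u ≡ a → Homogeneous b g → Homogeneous (a + b) (map (mulTerm u) g)
homogeneous-map-mulTerm u _ [] = []
homogeneous-map-mulTerm (c , (a , es)) {(d , (b , fs)) ∷ g} refl (refl ∷ hg) =
  degL-addL 0 es fs ∷ homogeneous-map-mulTerm (c , (a , es)) refl hg

homogeneous-mul : ∀ {a b f g} → Homogeneous a f → Homogeneous b g → Homogeneous (a + b) (mul f g)
homogeneous-mul {f = []} [] hg = []
homogeneous-mul {f = u ∷ f} (hu ∷ hf) hg = AllP.++⁺ (homogeneous-map-mulTerm u hu hg) (homogeneous-mul hf hg)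

homogeneous-pow : ∀ {a f} → Homogeneous a f → ∀ e → Homogeneous (e * a) (pow f e)
homogeneous-pow hf zero = refl ∷ []
homogeneous-pow hf (suc e) = homogeneous-mul hf (homogeneous-pow hf e)

homogeneous-scale : ∀ {d f} c → Homogeneous d f → Homogeneous d (scale c f)
homogeneous-scale c [] = []
homogeneous-scale c (hu ∷ hf) = hu ∷ homogeneous-scale c hf

degL-replicate : ∀ z k es → degL k (replicate z 0 ++ es) ≡ degL (z + k) es
degL-replicate zero k es = refl
degL-replicate (suc z) k es = trans (degL-replicate z (suc k) es) (cong (λ j → degL j es) (ℕP.+-suc z k))

homogeneous-pS : ∀ k → Homogeneous (suc k) (pS k)
homogeneous-pS k = trans (degL-replicate k 0 (1 ∷ [])) (solve 1 (λ k → con 1 :* (con 1 :+ (k :+ con 0)) :+ con 0 := con 1 :+ k) refl k) ∷ []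

homogeneous-plethL : ∀ k es → Homogeneous (degL k es) (plethL k es)
homogeneous-plethL k [] = refl ∷ []
homogeneous-plethL k (e ∷ es) =
  homogeneous-mul (homogeneous-pow (homogeneous-mul {a = 0} {f = tPow (suc k) ++ neg one} (refl ∷ refl ∷ []) (homogeneous-pS k)) e)
                  (homogeneous-plethL (suc k) es)

homogeneous-pleth : ∀ {d f} → Homogeneous d f → Homogeneous d (pleth f)
homogeneous-pleth {f = []} [] = []
homogeneous-pleth {f = (c , (a , es)) ∷ f} (refl ∷ hf) =
  AllP.++⁺ (homogeneous-mul {a = 0} {f = [ (c , (a , [])) ]} (refl ∷ []) (homogeneous-plethL 0 es)) (homogeneous-pleth hf)

-- Satisfied by hsRev n = [h_n, …, h_0]: each entry is homogeneous of degree the number of entries after it.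
Graded : List Sym → Set
Graded [] = ⊤
Graded (x ∷ xs) = Homogeneous (length xs) x × Graded xs

NewtonSum : (ℕ → List Sym → Sym) → Set
NewtonSum F = (∀ i → F i [] ≡ []) × (∀ i x xs → F i (x ∷ xs) ≡ mul (pS i) x ++ F (suc i) xs)

newtonSum-homogeneous : ∀ F → NewtonSum F → ∀ i xs → Graded xs → Homogeneous (i + length xs) (F i xs)
newtonSum-homogeneous F (F[] , F∷) i [] _ rewrite F[] i = []
newtonSum-homogeneous F (F[] , F∷) i (x ∷ xs) (hx , hxs) rewrite F∷ i x xs | ℕP.+-suc i (length xs) =
  AllP.++⁺ (homogeneous-mul (homogeneous-pS i) hx) (newtonSum-homogeneous F (F[] , F∷) (suc i) xs hxs)

mutual
  hsRev-graded : ∀ n → Graded (hsRev n)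
  hsRev-graded zero = refl ∷ [] , tt
  hsRev-graded (suc n) = h-suc-homogeneous n , hsRev-graded n

  -- Newton's summation function is local to hsRev, so it cannot be named here: it is left
  -- for Agda to infer, which needs it applied to a variable index, hence the abstracted literal 2.
  h-suc-homogeneous : ∀ n → Homogeneous (length (hsRev n)) (h (suc n))
  h-suc-homogeneous n = homogeneous (hsRev-graded n)
    where
    newtonSum : ℕ → List Sym → Sym
    newtonSum = _
    homogeneous : Graded (hsRev n) → Homogeneous (length (hsRev n)) (h (suc n))
    homogeneous with hsRev n
    ... | [] = λ _ → []
    ... | x ∷ [] = λ (hx , _) → homogeneous-scale ((+ 1) / suc n) (AllP.++⁺ (homogeneous-mul (homogeneous-pS 0) hx) [])
    ... | x ∷ y ∷ xs with 2 in eq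
    ... | i = λ (hx , hy , hxs) → homogeneous-scale ((+ 1) / suc n) (AllP.++⁺ (homogeneous-mul (homogeneous-pS 0) hx)
                (AllP.++⁺ (homogeneous-mul (homogeneous-pS 1) hy)
                   (All.map (λ deg≡ → trans deg≡ (cong (_+ length xs) (sym eq)))
                      (newtonSum-homogeneous newtonSum ((λ _ → refl) , (λ _ _ _ → refl)) i xs hxs))))

length-hsRev : ∀ n → length (hsRev n) ≡ suc n
length-hsRev zero = refl
length-hsRev (suc n) = cong suc (length-hsRev n)

homogeneous-h : ∀ j → Homogeneous j (h j)
homogeneous-h zero = refl ∷ []
homogeneous-h (suc n) = subst (λ d → Homogeneous d (h (suc n))) (length-hsRev n) (h-suc-homogeneous n)

degL-derivL : ∀ k es {e fs} → derivL k es ≡ (suc e , fs) → ∀ j → degL j es ≡ suc (j + k) + degL j fs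
degL-derivL zero (suc e ∷ es) refl j =
  solve 3 (λ e j r → (con 1 :+ e) :* (con 1 :+ j) :+ r := con 1 :+ (j :+ con 0) :+ (e :* (con 1 :+ j) :+ r))
        refl e j (degL (suc j) es)
degL-derivL (suc k) (e′ ∷ es) eq j with derivL k es in eq′
degL-derivL (suc k) (e′ ∷ es) {e} refl j | (.(suc e) , fs)
  rewrite degL-derivL k es eq′ (suc j) | ℕP.+-suc j k =
  solve 4 (λ e′ j k r → e′ :* (con 1 :+ j) :+ ((con 1 :+ ((con 1 :+ j) :+ k)) :+ r)
                     := (con 1 :+ (con 1 :+ (j :+ k))) :+ (e′ :* (con 1 :+ j) :+ r))
        refl e′ j k (degL (suc j) fs)

degreeBelow-deriv : ∀ d k g → DegreeBelow (d + suc k) g → DegreeBelow d (deriv k g)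
degreeBelow-deriv d k [] [] = []
degreeBelow-deriv d k ((c , (a , es)) ∷ g) (lt ∷ lts) with derivL k es in eq
... | (zero , fs) = degreeBelow-deriv d k g lts
... | (suc e , fs) = lt′ ∷ degreeBelow-deriv d k g lts
  where
  lt′ : degL 0 fs < d
  lt′ = ℕP.+-cancelʳ-< (suc k) (degL 0 fs) d
          (subst (_< d + suc k) (trans (degL-derivL k es eq 0) (ℕP.+-comm (suc k) (degL 0 fs))) lt)

degreeBelow-scale : ∀ {d} c g → DegreeBelow d g → DegreeBelow d (scale c g)
degreeBelow-scale c [] [] = []
degreeBelow-scale c (u ∷ g) (lt ∷ lts) = lt ∷ degreeBelow-scale c g lts

degreeBelow-iter-pperp : ∀ e d k g → DegreeBelow (d + e * suc k) g → DegreeBelow d (iter e (pperp k) g)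
degreeBelow-iter-pperp zero d k g lt = subst (λ z → DegreeBelow z g) (ℕP.+-identityʳ d) lt
degreeBelow-iter-pperp (suc e) d k g lt =
  degreeBelow-scale ((+ suc k) / 1) _ (degreeBelow-deriv d k _ (degreeBelow-iter-pperp e (d + suc k) k g
    (subst (λ z → DegreeBelow z g) (sym (ℕP.+-assoc d (suc k) (e * suc k))) lt)))

degreeBelow-perpExp : ∀ k es d g → DegreeBelow (d + degL k es) g → DegreeBelow d (perpExp k es g)
degreeBelow-perpExp k [] d g lt = subst (λ z → DegreeBelow z g) (ℕP.+-identityʳ d) lt
degreeBelow-perpExp k (e ∷ es) d g lt =
  degreeBelow-iter-pperp e d k _ (degreeBelow-perpExp (suc k) es (d + e * suc k) g
    (subst (λ z → DegreeBelow z g) (sym (ℕP.+-assoc d (e * suc k) (degL (suc k) es))) lt))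

degreeBelow-zero : ∀ g → DegreeBelow 0 g → g ≡ []
degreeBelow-zero [] [] = refl

degreeBelow-mono : ∀ {a b} g → a ≤ b → DegreeBelow a g → DegreeBelow b g
degreeBelow-mono g a≤b = All.map (λ lt → ℕP.<-≤-trans lt a≤b)

degreeBelow-deg : ∀ g → DegreeBelow (suc (deg g)) g
degreeBelow-deg [] = []
degreeBelow-deg ((c , (a , es)) ∷ g) =
  s≤s (ℕP.m≤m⊔n (degL 0 es) (deg g)) ∷ degreeBelow-mono g (s≤s (ℕP.m≤n⊔m (degL 0 es) (deg g))) (degreeBelow-deg g)

perp-vanishes : ∀ j P g → Homogeneous j P → DegreeBelow j g → perp P g ≡ []
perp-vanishes j [] g [] lt = refl
perp-vanishes j ((c , (a , es)) ∷ P) g (refl ∷ hP) lt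
  rewrite degreeBelow-zero (perpExp 0 es g) (degreeBelow-perpExp 0 es 0 g lt) = perp-vanishes j P g hP lt

perpTerm : Term → Sym → Sym
perpTerm (c , (a , es)) g = mul [ (c , (a , [])) ] (perpExp 0 es g)

mul-[_] : ∀ u f → mul [ u ] f ≡ map (mulTerm u) f
mul-[ u ] f = LP.++-identityʳ _

mul-++ : ∀ f g₁ g₂ → mul f (g₁ ++ g₂) ↭ mul f g₁ ++ mul f g₂
mul-++ f g₁ g₂ = ↭-trans (↭-reflexive (LP.concatMap-cong (λ u → LP.map-++ (mulTerm u) g₁ g₂) f))
                         (concatMap-++-distrib (λ u → map (mulTerm u) g₁) (λ u → map (mulTerm u) g₂) f)

mul⁺ : ∀ f {g₁ g₂} → g₁ ↭ g₂ → mul f g₁ ↭ mul f g₂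
mul⁺ f p = concatMap-cong-↭ f (λ u → ↭P.map⁺ (mulTerm u) p)

mul-[]ʳ : ∀ f → mul f [] ≡ []
mul-[]ʳ [] = refl
mul-[]ʳ (u ∷ f) = mul-[]ʳ f

pperp-++ : ∀ k g₁ g₂ → pperp k (g₁ ++ g₂) ≡ pperp k g₁ ++ pperp k g₂
pperp-++ k g₁ g₂ = trans (cong (scale ((+ suc k) / 1)) (LP.concatMap-++ _ g₁ g₂)) (LP.map-++ _ (deriv k g₁) (deriv k g₂))

iter-pperp-++ : ∀ e k g₁ g₂ → iter e (pperp k) (g₁ ++ g₂) ≡ iter e (pperp k) g₁ ++ iter e (pperp k) g₂
iter-pperp-++ zero k g₁ g₂ = refl
iter-pperp-++ (suc e) k g₁ g₂ = trans (cong (pperp k) (iter-pperp-++ e k g₁ g₂)) (pperp-++ k (iter e (pperp k) g₁) (iter e (pperp k) g₂))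

perpExp-++ : ∀ k es g₁ g₂ → perpExp k es (g₁ ++ g₂) ≡ perpExp k es g₁ ++ perpExp k es g₂
perpExp-++ k [] g₁ g₂ = refl
perpExp-++ k (e ∷ es) g₁ g₂ = trans (cong (iter e (pperp k)) (perpExp-++ (suc k) es g₁ g₂))
                                    (iter-pperp-++ e k (perpExp (suc k) es g₁) (perpExp (suc k) es g₂))

perpTerm-++ : ∀ u g₁ g₂ → perpTerm u (g₁ ++ g₂) ≡ perpTerm u g₁ ++ perpTerm u g₂
perpTerm-++ (c , (a , es)) g₁ g₂ = begin
  mul [ v ] (perpExp 0 es (g₁ ++ g₂))                         ≡⟨ cong (mul [ v ]) (perpExp-++ 0 es g₁ g₂) ⟩
  mul [ v ] (perpExp 0 es g₁ ++ perpExp 0 es g₂)              ≡⟨ mul-[ v ] _ ⟩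
  map (mulTerm v) (perpExp 0 es g₁ ++ perpExp 0 es g₂)        ≡⟨ LP.map-++ (mulTerm v) (perpExp 0 es g₁) _ ⟩
  map (mulTerm v) (perpExp 0 es g₁) ++ map (mulTerm v) (perpExp 0 es g₂)
    ≡⟨ sym (cong₂ _++_ (mul-[ v ] (perpExp 0 es g₁)) (mul-[ v ] (perpExp 0 es g₂))) ⟩
  mul [ v ] (perpExp 0 es g₁) ++ mul [ v ] (perpExp 0 es g₂)  ∎
  where
  open ≡-Reasoning
  v = (c , (a , []))

perp-++ : ∀ P g₁ g₂ → perp P (g₁ ++ g₂) ↭ perp P g₁ ++ perp P g₂
perp-++ P g₁ g₂ = ↭-trans (↭-reflexive (LP.concatMap-cong (λ u → perpTerm-++ u g₁ g₂) P))
                          (concatMap-++-distrib (λ u → perpTerm u g₁) (λ u → perpTerm u g₂) P)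

pperp⁺ : ∀ k {g₁ g₂} → g₁ ↭ g₂ → pperp k g₁ ↭ pperp k g₂
pperp⁺ k p = ↭P.map⁺ _ (concatMap⁺ _ p)

iter-pperp⁺ : ∀ e k {g₁ g₂} → g₁ ↭ g₂ → iter e (pperp k) g₁ ↭ iter e (pperp k) g₂
iter-pperp⁺ zero k p = p
iter-pperp⁺ (suc e) k p = pperp⁺ k (iter-pperp⁺ e k p)

perpExp⁺ : ∀ k es {g₁ g₂} → g₁ ↭ g₂ → perpExp k es g₁ ↭ perpExp k es g₂
perpExp⁺ k [] p = p
perpExp⁺ k (e ∷ es) p = iter-pperp⁺ e k (perpExp⁺ (suc k) es p)

perp⁺ : ∀ P {g₁ g₂} → g₁ ↭ g₂ → perp P g₁ ↭ perp P g₂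
perp⁺ P p = concatMap-cong-↭ P (λ { (c , (a , es)) → mul⁺ [ (c , (a , [])) ] (perpExp⁺ 0 es p) })

perp-[]ʳ : ∀ P → perp P [] ≡ []
perp-[]ʳ [] = refl
perp-[]ʳ ((c , (a , es)) ∷ P) rewrite degreeBelow-zero (perpExp 0 es []) (degreeBelow-perpExp 0 es 0 [] []) = perp-[]ʳ P

deg-↭ : ∀ {g₁ g₂} → g₁ ↭ g₂ → deg g₁ ≡ deg g₂
deg-↭ ↭.refl = refl
deg-↭ (prep u p) = cong (degree u ⊔_) (deg-↭ p)
deg-↭ {g₁ = u ∷ v ∷ g} (swap u v p) = begin
  degree u ⊔ (degree v ⊔ deg g)  ≡⟨ ℕP.⊔-assoc (degree u) _ _ ⟨
  (degree u ⊔ degree v) ⊔ deg g  ≡⟨ cong (_⊔ deg g) (ℕP.⊔-comm (degree u) _) ⟩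
  (degree v ⊔ degree u) ⊔ deg g  ≡⟨ ℕP.⊔-assoc (degree v) _ _ ⟩
  degree v ⊔ (degree u ⊔ deg g)  ≡⟨ cong (λ z → degree v ⊔ (degree u ⊔ z)) (deg-↭ p) ⟩
  _                              ∎
  where open ≡-Reasoning
deg-↭ (↭.trans p q) = trans (deg-↭ p) (deg-↭ q)

deg-++ : ∀ g₁ g₂ → deg (g₁ ++ g₂) ≡ deg g₁ ⊔ deg g₂
deg-++ [] g₂ = refl
deg-++ (u ∷ g₁) g₂ = trans (cong (degree u ⊔_) (deg-++ g₁ g₂)) (sym (ℕP.⊔-assoc (degree u) (deg g₁) (deg g₂)))

Bterm : ℤ → Sym → ℕ → Sym
Bterm x g j = mul (s (x ℤ.+ + j)) (perp (pleth (s (+ j))) g)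

Bterm-vanishes : ∀ x g j → deg g < j → Bterm x g j ≡ []
Bterm-vanishes x g j deg<j
  rewrite perp-vanishes j (pleth (s (+ j))) g (homogeneous-pleth (homogeneous-h j)) (degreeBelow-mono g deg<j (degreeBelow-deg g))
  = mul-[]ʳ (s (x ℤ.+ + j))

concatMap-upTo-vanishing : {A : Set} (G : ℕ → List A) (M k : ℕ) → (∀ j → M ≤ j → G j ≡ []) →
                           concatMap G (upTo (M + k)) ≡ concatMap G (upTo M)
concatMap-upTo-vanishing G M zero G≡[] = cong (concatMap G ∘ upTo) (ℕP.+-identityʳ M)
concatMap-upTo-vanishing G M (suc k) G≡[] = begin
  concatMap G (upTo (M + suc k))             ≡⟨ cong (concatMap G ∘ upTo) (ℕP.+-suc M k) ⟩
  concatMap G (upTo (suc (M + k)))           ≡⟨ cong (concatMap G) (LP.upTo-∷ʳ (M + k)) ⟨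
  concatMap G (upTo (M + k) ++ [ M + k ])    ≡⟨ LP.concatMap-++ G (upTo (M + k)) _ ⟩
  concatMap G (upTo (M + k)) ++ G (M + k) ++ []
    ≡⟨ cong (λ z → concatMap G (upTo (M + k)) ++ z ++ []) (G≡[] (M + k) (ℕP.m≤m+n M k)) ⟩
  concatMap G (upTo (M + k)) ++ []           ≡⟨ LP.++-identityʳ _ ⟩
  concatMap G (upTo (M + k))                 ≡⟨ concatMap-upTo-vanishing G M k G≡[] ⟩
  concatMap G (upTo M)                       ∎
  where open ≡-Reasoning

B-truncate : ∀ x g N → deg g < N → concatMap (Bterm x g) (upTo N) ≡ B x g
B-truncate x g N deg<N with ℕP.m≤n⇒∃[o]m+o≡n deg<N
... | k , refl = concatMap-upTo-vanishing (Bterm x g) (suc (deg g)) k (Bterm-vanishes x g)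

B-++ : ∀ x g₁ g₂ → B x (g₁ ++ g₂) ↭ B x g₁ ++ B x g₂
B-++ x g₁ g₂ = begin
  concatMap (Bterm x (g₁ ++ g₂)) (upTo N)
    ↭⟨ concatMap-cong-↭ (upTo N) (λ j → ↭-trans (mul⁺ (s (x ℤ.+ + j)) (perp-++ (pleth (s (+ j))) g₁ g₂))
                                              (mul-++ (s (x ℤ.+ + j)) (perp (pleth (s (+ j))) g₁) (perp (pleth (s (+ j))) g₂))) ⟩
  concatMap (λ j → Bterm x g₁ j ++ Bterm x g₂ j) (upTo N)
    ↭⟨ concatMap-++-distrib (Bterm x g₁) (Bterm x g₂) (upTo N) ⟩
  concatMap (Bterm x g₁) (upTo N) ++ concatMap (Bterm x g₂) (upTo N)
    ≡⟨ cong₂ _++_ (B-truncate x g₁ N (s≤s (subst (deg g₁ ≤_) (sym (deg-++ g₁ g₂)) (ℕP.m≤m⊔n _ _))))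
                  (B-truncate x g₂ N (s≤s (subst (deg g₂ ≤_) (sym (deg-++ g₁ g₂)) (ℕP.m≤n⊔m _ _)))) ⟩
  B x g₁ ++ B x g₂ ∎
  where
  open ↭.PermutationReasoning
  N = suc (deg (g₁ ++ g₂))

B⁺ : ∀ x {g₁ g₂} → g₁ ↭ g₂ → B x g₁ ↭ B x g₂
B⁺ x {g₁} {g₂} p =
  ↭-trans (concatMap-cong-↭ (upTo (suc (deg g₁))) (λ j → mul⁺ (s (x ℤ.+ + j)) (perp⁺ (pleth (s (+ j))) p)))
          (↭-reflexive (cong (λ d → concatMap (Bterm x g₂) (upTo (suc d))) (deg-↭ p)))

B-[] : ∀ x → B x [] ≡ []
B-[] x rewrite perp-[]ʳ (pleth (s (+ 0))) = trans (LP.++-identityʳ _) (mul-[]ʳ (s (x ℤ.+ + 0)))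

scaleMono : ℚ → ℕ → Term → Term
scaleMono r k (c , (a , es)) = (r ℚ.* c , (k + a , es))

private
  *-left-comm : ∀ a b c → a ℚ.* (b ℚ.* c) ≡ b ℚ.* (a ℚ.* c)
  *-left-comm a b c = trans (sym (ℚP.*-assoc a b c)) (trans (cong (ℚ._* c) (ℚP.*-comm a b)) (ℚP.*-assoc b a c))

module MonomialScaling (r : ℚ) (k : ℕ) where

  σ : Term → Term
  σ = scaleMono r k

  deriv-comm : ∀ i g → deriv i (map σ g) ≡ map σ (deriv i g)
  deriv-comm i [] = refl
  deriv-comm i ((c , (a , es)) ∷ g) with derivL i es
  ... | (zero , fs) = deriv-comm i g
  ... | (suc e , fs) = cong₂ _∷_ (cong (_, (k + a , fs)) (ℚP.*-assoc r c _)) (deriv-comm i g)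

  scale-comm : ∀ c g → scale c (map σ g) ≡ map σ (scale c g)
  scale-comm c [] = refl
  scale-comm c ((d , m) ∷ g) = cong₂ _∷_ (cong (_, _) (*-left-comm c r d)) (scale-comm c g)

  iter-pperp-comm : ∀ e i g → iter e (pperp i) (map σ g) ≡ map σ (iter e (pperp i) g)
  iter-pperp-comm zero i g = refl
  iter-pperp-comm (suc e) i g rewrite iter-pperp-comm e i g | deriv-comm i (iter e (pperp i) g) =
    scale-comm ((+ suc i) / 1) (deriv i (iter e (pperp i) g))

  perpExp-comm : ∀ i es g → perpExp i es (map σ g) ≡ map σ (perpExp i es g)
  perpExp-comm i [] g = refl
  perpExp-comm i (e ∷ es) g = trans (cong (iter e (pperp i)) (perpExp-comm (suc i) es g)) (iter-pperp-comm e i (perpExp (suc i) es g))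

  map-mulTerm-comm : ∀ u g → map (mulTerm u) (map σ g) ≡ map σ (map (mulTerm u) g)
  map-mulTerm-comm u [] = refl
  map-mulTerm-comm (c , (a , es)) ((d , (b , fs)) ∷ g) =
    cong₂ _∷_ (cong₂ _,_ (*-left-comm c r d) (cong (_, addL es fs) (solve 3 (λ a k b → a :+ (k :+ b) := k :+ (a :+ b)) refl a k b)))
              (map-mulTerm-comm (c , (a , es)) g)

  mul-comm : ∀ f g → mul f (map σ g) ≡ map σ (mul f g)
  mul-comm f g = trans (LP.concatMap-cong (λ u → map-mulTerm-comm u g) f) (sym (LP.map-concatMap σ _ f))

  perp-comm : ∀ P g → perp P (map σ g) ≡ map σ (perp P g)
  perp-comm P g = trans (LP.concatMap-cong perpTerm-comm P) (sym (LP.map-concatMap σ (λ u → perpTerm u g) P))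
    where
    perpTerm-comm : ∀ u → perpTerm u (map σ g) ≡ map σ (perpTerm u g)
    perpTerm-comm (c , (a , es)) = trans (cong (mul [ v ]) (perpExp-comm 0 es g)) (mul-comm [ v ] (perpExp 0 es g))
      where v = (c , (a , []))

  deg-map : ∀ g → deg (map σ g) ≡ deg g
  deg-map [] = refl
  deg-map (u ∷ g) = cong (degree u ⊔_) (deg-map g)

  B-comm : ∀ x g → B x (map σ g) ≡ map σ (B x g)
  B-comm x g = begin
    concatMap (Bterm x (map σ g)) (upTo (suc (deg (map σ g))))  ≡⟨ cong (λ d → concatMap (Bterm x (map σ g)) (upTo (suc d))) (deg-map g) ⟩
    concatMap (Bterm x (map σ g)) (upTo (suc (deg g)))          ≡⟨ LP.concatMap-cong Bterm-comm (upTo (suc (deg g))) ⟩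
    concatMap (map σ ∘ Bterm x g) (upTo (suc (deg g)))          ≡⟨ LP.map-concatMap σ (Bterm x g) (upTo (suc (deg g))) ⟨
    map σ (B x g)                                               ∎
    where
    open ≡-Reasoning
    Bterm-comm : ∀ j → Bterm x (map σ g) j ≡ map σ (Bterm x g j)
    Bterm-comm j = trans (cong (mul (s (x ℤ.+ + j))) (perp-comm (pleth (s (+ j))) g)) (mul-comm (s (x ℤ.+ + j)) (perp (pleth (s (+ j))) g))

  applyAll-comm : ∀ w g → applyAll w (map σ g) ≡ map σ (applyAll w g)
  applyAll-comm [] g = refl
  applyAll-comm (x ∷ w) g = trans (cong (B x) (applyAll-comm w g)) (B-comm x (applyAll w g))

applyAll⁺ : ∀ w {g₁ g₂} → g₁ ↭ g₂ → applyAll w g₁ ↭ applyAll w g₂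
applyAll⁺ [] p = p
applyAll⁺ (x ∷ w) p = B⁺ x (applyAll⁺ w p)

applyAll-++ : ∀ w g₁ g₂ → applyAll w (g₁ ++ g₂) ↭ applyAll w g₁ ++ applyAll w g₂
applyAll-++ [] g₁ g₂ = ↭-refl
applyAll-++ (x ∷ w) g₁ g₂ = ↭-trans (B⁺ x (applyAll-++ w g₁ g₂)) (B-++ x (applyAll w g₁) (applyAll w g₂))

applyAll-[] : ∀ w → applyAll w [] ≡ []
applyAll-[] [] = refl
applyAll-[] (x ∷ w) rewrite applyAll-[] w = B-[] x

applyAll-++ˡ : ∀ w w′ g → applyAll (w ++ w′) g ≡ applyAll w (applyAll w′ g)
applyAll-++ˡ [] w′ g = refl
applyAll-++ˡ (x ∷ w) w′ g = cong (B x) (applyAll-++ˡ w w′ g)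

applyAll-concatMap : {A : Set} (w : List ℤ) (φ : A → Sym) (xs : List A) →
                     applyAll w (concatMap φ xs) ↭ concatMap (applyAll w ∘ φ) xs
applyAll-concatMap w φ [] = ↭-reflexive (applyAll-[] w)
applyAll-concatMap w φ (x ∷ xs) = ↭-trans (applyAll-++ w (φ x) (concatMap φ xs)) (↭P.++⁺ˡ (applyAll w (φ x)) (applyAll-concatMap w φ xs))

-- (k , w) stands for (-t)^k B_{w₁} ⋯ B_{w_L}, before any raising operator is applied.
Word : Set
Word = ℕ × List ℤ

raiseStep : ℕ × ℕ → List Word → List Word
raiseStep (a , b) = concatMap (λ { (k , w) → (k , w) ∷ (suc k , raise a b w) ∷ [] })

raiseAll : List (ℕ × ℕ) → List Word → List Word
raiseAll P X = foldr raiseStep X P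

expansion : List ℤ → List Word
expansion v = raiseAll (pairs (length v)) [ (0 , v) ]

-- the coefficient of negT, so that pow negT k computes to the single term (-1)^k t^k
minusOne : ℚ
minusOne = (ℚ.- ℚ.1ℚ) ℚ.* ℚ.1ℚ

sign : ℕ → ℚ
sign zero = ℚ.1ℚ
sign (suc k) = minusOne ℚ.* sign k

pow-negT : ∀ k → pow negT k ≡ [ (sign k , (k , [])) ]
pow-negT zero = refl
pow-negT (suc k) rewrite pow-negT k = refl

timesNegT : ℕ → Term → Term
timesNegT k = scaleMono (sign k) k

mul-pow-negT : ∀ k f → mul (pow negT k) f ≡ map (timesNegT k) f
mul-pow-negT k f = trans (cong (λ c → mul c f) (pow-negT k)) (mul-[ (sign k , (k , [])) ] f)

evalWord : Word → Sym → Sym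
evalWord (k , w) f = map (timesNegT k) (applyAll w f)

eval : List Word → Sym → Sym
eval X f = concatMap (λ p → evalWord p f) X

asExpanded : Word → Sym × List ℤ
asExpanded (k , w) = (pow negT k , w)

-- the step function local to expand, restated so that expand v unfolds to a foldr of it
expandStep : ℕ × ℕ → List (Sym × List ℤ) → List (Sym × List ℤ)
expandStep (a , b) = concatMap (λ { (c , w) → (c , w) ∷ (mul negT c , raise a b w) ∷ [] })

expand-raiseAll : ∀ P v → foldr expandStep [ (one , v) ] P ≡ map asExpanded (raiseAll P [ (0 , v) ])
expand-raiseAll [] v = refl
expand-raiseAll ((a , b) ∷ P) v = trans (cong (expandStep (a , b)) (expand-raiseAll P v)) (step (raiseAll P [ (0 , v) ]))
  where
  step : ∀ X → expandStep (a , b) (map asExpanded X)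
             ≡ map asExpanded (raiseStep (a , b) X)
  step [] = refl
  step ((k , w) ∷ X) = cong (λ Y → (pow negT k , w) ∷ (mul negT (pow negT k) , raise a b w) ∷ Y) (step X)

Bv-eval : ∀ v f → Bv v f ≡ eval (expansion v) f
Bv-eval v f = begin
  concatMap evalExpanded (foldr expandStep [ (one , v) ] (pairs (length v)))
    ≡⟨ cong (concatMap evalExpanded) (expand-raiseAll (pairs (length v)) v) ⟩
  concatMap evalExpanded (map asExpanded (expansion v))
    ≡⟨ LP.concatMap-map evalExpanded _ (expansion v) ⟩
  concatMap (λ { (k , w) → mul (pow negT k) (applyAll w f) }) (expansion v)
    ≡⟨ LP.concatMap-cong (λ { (k , w) → mul-pow-negT k (applyAll w f) }) (expansion v) ⟩
  eval (expansion v) f ∎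
  where
  open ≡-Reasoning
  evalExpanded : Sym × List ℤ → Sym
  evalExpanded (c , w) = mul c (applyAll w f)

sign-+ : ∀ k k′ → sign (k + k′) ≡ sign k ℚ.* sign k′
sign-+ zero k′ = sym (ℚP.*-identityˡ (sign k′))
sign-+ (suc k) k′ = trans (cong (minusOne ℚ.*_) (sign-+ k k′)) (sym (ℚP.*-assoc minusOne (sign k) (sign k′)))

timesNegT-timesNegT : ∀ k k′ u → timesNegT k (timesNegT k′ u) ≡ timesNegT (k + k′) u
timesNegT-timesNegT k k′ (c , (a , es)) =
  cong₂ _,_ (trans (sym (ℚP.*-assoc (sign k) (sign k′) c)) (cong (ℚ._* c) (sym (sign-+ k k′))))
            (cong (_, es) (sym (ℕP.+-assoc k k′ a)))

map-timesNegT-timesNegT : ∀ k k′ g → map (timesNegT k) (map (timesNegT k′) g) ≡ map (timesNegT (k + k′)) g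
map-timesNegT-timesNegT k k′ g = trans (sym (LP.map-∘ g)) (LP.map-cong (timesNegT-timesNegT k k′) g)

shiftExp : ℕ → Word → Word
shiftExp j (k , w) = (j + k , w)

map-timesNegT-eval : ∀ j X f → map (timesNegT j) (eval X f) ≡ eval (map (shiftExp j) X) f
map-timesNegT-eval j X f = trans (LP.map-concatMap (timesNegT j) (λ p → evalWord p f) X)
  (trans (LP.concatMap-cong (λ { (k , w) → map-timesNegT-timesNegT j k (applyAll w f) }) X)
         (sym (LP.concatMap-map (λ p → evalWord p f) (shiftExp j) X)))

eval⁺ : ∀ {X Y} f → X ↭ Y → eval X f ↭ eval Y f
eval⁺ f = concatMap⁺ (λ p → evalWord p f)

eval-concatMap : {A : Set} (φ : A → List Word) (xs : List A) (f : Sym) → eval (concatMap φ xs) f ≡ concatMap (λ x → eval (φ x) f) xs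
eval-concatMap φ xs f = concatMap-concatMap (λ p → evalWord p f) φ xs

_·_ : Word → Word → Word
(k , w) · (k′ , w′) = (k + k′ , w ++ w′)

_⊗_ : List Word → List Word → List Word
X ⊗ Y = concatMap (λ p → map (p ·_) Y) X

eval-⊗ : ∀ X Y f → eval X (eval Y f) ↭ eval (X ⊗ Y) f
eval-⊗ X Y f = begin
  eval X (eval Y f)
    ↭⟨ concatMap-cong-↭ X (λ { (k , w) → evalWord-eval k w }) ⟩
  concatMap (λ { (k , w) → concatMap (λ { (k′ , w′) → evalWord (k + k′ , w ++ w′) f }) Y }) X
    ≡⟨ LP.concatMap-cong (λ { (k , w) → sym (LP.concatMap-map (λ p → evalWord p f) _ Y) }) X ⟩
  concatMap (λ p → eval (map (p ·_) Y) f) X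
    ≡⟨ eval-concatMap _ X f ⟨
  eval (X ⊗ Y) f ∎
  where
  open ↭.PermutationReasoning
  evalWord-eval : ∀ k w → evalWord (k , w) (eval Y f) ↭ concatMap (λ { (k′ , w′) → evalWord (k + k′ , w ++ w′) f }) Y
  evalWord-eval k w = begin
    map (timesNegT k) (applyAll w (eval Y f))
      ↭⟨ ↭P.map⁺ (timesNegT k) (applyAll-concatMap w (λ p → evalWord p f) Y) ⟩
    map (timesNegT k) (concatMap (λ p → applyAll w (evalWord p f)) Y)
      ≡⟨ LP.map-concatMap (timesNegT k) _ Y ⟩
    concatMap (λ p → map (timesNegT k) (applyAll w (evalWord p f))) Y
      ≡⟨ LP.concatMap-cong (λ { (k′ , w′) → commute k′ w′ }) Y ⟩
    concatMap (λ { (k′ , w′) → evalWord (k + k′ , w ++ w′) f }) Y ∎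
    where
    commute : ∀ k′ w′ → map (timesNegT k) (applyAll w (map (timesNegT k′) (applyAll w′ f))) ≡ evalWord (k + k′ , w ++ w′) f
    commute k′ w′ rewrite MonomialScaling.applyAll-comm (sign k′) k′ w (applyAll w′ f)
                        | map-timesNegT-timesNegT k k′ (applyAll w (applyAll w′ f))
                        | applyAll-++ˡ w w′ f = refl

modifyAt-comm : ∀ i j (f g : ℤ → ℤ) → (∀ x → f (g x) ≡ g (f x)) → ∀ w →
                modifyAt i f (modifyAt j g w) ≡ modifyAt j g (modifyAt i f w)
modifyAt-comm i j f g fg≡gf [] = refl
modifyAt-comm zero zero f g fg≡gf (x ∷ w) = cong (_∷ w) (fg≡gf x)
modifyAt-comm zero (suc j) f g fg≡gf (x ∷ w) = refl
modifyAt-comm (suc i) zero f g fg≡gf (x ∷ w) = refl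
modifyAt-comm (suc i) (suc j) f g fg≡gf (x ∷ w) = cong (x ∷_) (modifyAt-comm i j f g fg≡gf w)

private
  inc dec : ℤ → ℤ
  inc x = x ℤ.+ + 1
  dec x = x ℤ.- + 1

  +-right-comm : ∀ x a b → (x ℤ.+ a) ℤ.+ b ≡ (x ℤ.+ b) ℤ.+ a
  +-right-comm x a b = trans (ℤP.+-assoc x a b) (trans (cong (λ z → x ℤ.+ z) (ℤP.+-comm a b)) (sym (ℤP.+-assoc x b a)))

raise-comm : ∀ a b c d w → raise a b (raise c d w) ≡ raise c d (raise a b w)
raise-comm a b c d w = begin
  modifyAt b dec (modifyAt a inc (modifyAt d dec (modifyAt c inc w)))
    ≡⟨ cong (modifyAt b dec) (modifyAt-comm a d inc dec (λ x → +-right-comm x _ _) (modifyAt c inc w)) ⟩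
  modifyAt b dec (modifyAt d dec (modifyAt a inc (modifyAt c inc w)))
    ≡⟨ cong (modifyAt b dec ∘ modifyAt d dec) (modifyAt-comm a c inc inc (λ _ → refl) w) ⟩
  modifyAt b dec (modifyAt d dec (modifyAt c inc (modifyAt a inc w)))
    ≡⟨ modifyAt-comm b d dec dec (λ _ → refl) _ ⟩
  modifyAt d dec (modifyAt b dec (modifyAt c inc (modifyAt a inc w)))
    ≡⟨ cong (modifyAt d dec) (modifyAt-comm b c dec inc (λ x → +-right-comm x _ _) (modifyAt a inc w)) ⟩
  modifyAt d dec (modifyAt c inc (modifyAt b dec (modifyAt a inc w))) ∎
  where open ≡-Reasoning

raiseStep-comm : ∀ p p′ X → raiseStep p (raiseStep p′ X) ↭ raiseStep p′ (raiseStep p X)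
raiseStep-comm (a , b) (c , d) X = begin
  raiseStep (a , b) (raiseStep (c , d) X)                 ≡⟨ concatMap-concatMap _ _ X ⟩
  concatMap (λ p → raiseStep (a , b) (raiseStep (c , d) [ p ])) X ↭⟨ concatMap-cong-↭ X single ⟩
  concatMap (λ p → raiseStep (c , d) (raiseStep (a , b) [ p ])) X ≡⟨ concatMap-concatMap _ _ X ⟨
  raiseStep (c , d) (raiseStep (a , b) X)                 ∎
  where
  open ↭.PermutationReasoning
  single : ∀ p → raiseStep (a , b) (raiseStep (c , d) [ p ]) ↭ raiseStep (c , d) (raiseStep (a , b) [ p ])
  single (k , w) = prep _ (↭-trans (swap _ _ ↭-refl) (prep _ (prep _ (↭-reflexive (cong (λ v → [ (suc (suc k) , v) ]) (raise-comm a b c d w))))))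

raiseAll⁺ : ∀ P {X Y} → X ↭ Y → raiseAll P X ↭ raiseAll P Y
raiseAll⁺ [] p = p
raiseAll⁺ ((a , b) ∷ P) p = concatMap⁺ _ (raiseAll⁺ P p)

raiseAll-↭ : ∀ {P P′} → P ↭ P′ → ∀ X → raiseAll P X ↭ raiseAll P′ X
raiseAll-↭ ↭.refl X = ↭-refl
raiseAll-↭ (prep (a , b) p) X = concatMap⁺ _ (raiseAll-↭ p X)
raiseAll-↭ {P = p ∷ p′ ∷ P} (swap p p′ q) X =
  ↭-trans (raiseStep-comm p p′ (raiseAll P X)) (raiseAll⁺ (p′ ∷ p ∷ []) (raiseAll-↭ q X))
raiseAll-↭ (↭.trans p q) X = ↭-trans (raiseAll-↭ p X) (raiseAll-↭ q X)

raiseAll-++ : ∀ P X Y → raiseAll P (X ++ Y) ≡ raiseAll P X ++ raiseAll P Y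
raiseAll-++ [] X Y = refl
raiseAll-++ ((a , b) ∷ P) X Y = trans (cong (raiseStep (a , b)) (raiseAll-++ P X Y)) (LP.concatMap-++ _ (raiseAll P X) _)

raiseAll-[] : ∀ P → raiseAll P [] ≡ []
raiseAll-[] [] = refl
raiseAll-[] ((a , b) ∷ P) rewrite raiseAll-[] P = refl

raiseAll-concatMap : {A : Set} (P : List (ℕ × ℕ)) (φ : A → List Word) (xs : List A) →
                     raiseAll P (concatMap φ xs) ≡ concatMap (raiseAll P ∘ φ) xs
raiseAll-concatMap P φ [] = raiseAll-[] P
raiseAll-concatMap P φ (x ∷ xs) = trans (raiseAll-++ P (φ x) (concatMap φ xs)) (cong (raiseAll P (φ x) ++_) (raiseAll-concatMap P φ xs))

raiseAll-++ˡ : ∀ P Q X → raiseAll (P ++ Q) X ≡ raiseAll P (raiseAll Q X)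
raiseAll-++ˡ P Q X = LP.foldr-++ raiseStep X P Q

raiseAll-shiftExp : ∀ j P X → raiseAll P (map (shiftExp j) X) ≡ map (shiftExp j) (raiseAll P X)
raiseAll-shiftExp j [] X = refl
raiseAll-shiftExp j ((a , b) ∷ P) X = trans (cong (raiseStep (a , b)) (raiseAll-shiftExp j P X)) (step (raiseAll P X))
  where
  step : ∀ X → raiseStep (a , b) (map (shiftExp j) X) ≡ map (shiftExp j) (raiseStep (a , b) X)
  step [] = refl
  step ((k , w) ∷ X) = cong₂ _∷_ refl (cong₂ _∷_ (cong (_, raise a b w) (sym (ℕP.+-suc j k))) (step X))

shiftPairs : ℕ → List (ℕ × ℕ) → List (ℕ × ℕ)
shiftPairs r = map (λ { (a , b) → (r + a , r + b) })

prepend : List ℤ → Word → Word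
prepend x (k , w) = (k , x ++ w)

append : List ℤ → Word → Word
append t (k , w) = (k , w ++ t)

modifyAt-prepend : ∀ x i f w → modifyAt (length x + i) f (x ++ w) ≡ x ++ modifyAt i f w
modifyAt-prepend [] i f w = refl
modifyAt-prepend (y ∷ x) i f w = cong (y ∷_) (modifyAt-prepend x i f w)

raiseAll-prepend : ∀ x Q X → raiseAll (shiftPairs (length x) Q) (map (prepend x) X) ≡ map (prepend x) (raiseAll Q X)
raiseAll-prepend x [] X = refl
raiseAll-prepend x ((a , b) ∷ Q) X = trans (cong (raiseStep _) (raiseAll-prepend x Q X)) (step (raiseAll Q X))
  where
  raise-prepend : ∀ w → raise (length x + a) (length x + b) (x ++ w) ≡ x ++ raise a b w
  raise-prepend w = trans (cong (modifyAt (length x + b) dec) (modifyAt-prepend x a inc w)) (modifyAt-prepend x b dec _)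
  step : ∀ X → raiseStep (length x + a , length x + b) (map (prepend x) X) ≡ map (prepend x) (raiseStep (a , b) X)
  step [] = refl
  step ((k , w) ∷ X) = cong₂ _∷_ refl (cong₂ _∷_ (cong (suc k ,_) (raise-prepend w)) (step X))

modifyAt-append : ∀ i f y t → i < length y → modifyAt i f (y ++ t) ≡ modifyAt i f y ++ t
modifyAt-append zero f (x ∷ y) t i<len = refl
modifyAt-append (suc i) f (x ∷ y) t (s≤s i<len) = cong (x ∷_) (modifyAt-append i f y t i<len)

length-modifyAt : ∀ i f w → length (modifyAt i f w) ≡ length w
length-modifyAt i f [] = refl
length-modifyAt zero f (x ∷ w) = refl
length-modifyAt (suc i) f (x ∷ w) = cong suc (length-modifyAt i f w)

PairsBelow : ℕ → List (ℕ × ℕ) → Set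
PairsBelow L = All (λ { (a , b) → a < L × b < L })

OfLength : ℕ → List Word → Set
OfLength L = All (λ { (k , w) → length w ≡ L })

raiseAll-append : ∀ L t P X → PairsBelow L P → OfLength L X → raiseAll P (map (append t) X) ≡ map (append t) (raiseAll P X)
raiseAll-append L t P X below len = proj₁ (go P below)
  where
  raise-append : ∀ a b w → a < L → b < L → length w ≡ L → raise a b (w ++ t) ≡ raise a b w ++ t
  raise-append a b w a<L b<L refl = trans (cong (modifyAt b dec) (modifyAt-append a inc w t a<L))
    (modifyAt-append b dec (modifyAt a inc w) t (subst (b <_) (sym (length-modifyAt a inc w)) b<L))
  step : ∀ a b Y → a < L → b < L → OfLength L Y →
         raiseStep (a , b) (map (append t) Y) ≡ map (append t) (raiseStep (a , b) Y) × OfLength L (raiseStep (a , b) Y)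
  step a b [] a<L b<L [] = refl , []
  step a b ((k , w) ∷ Y) a<L b<L (lw ∷ lY) with step a b Y a<L b<L lY
  ... | eq , lY′ = cong₂ _∷_ refl (cong₂ _∷_ (cong (suc k ,_) (raise-append a b w a<L b<L lw)) eq)
                 , lw ∷ trans (length-modifyAt b dec (modifyAt a inc w)) (trans (length-modifyAt a inc w) lw) ∷ lY′
  go : ∀ P → PairsBelow L P → raiseAll P (map (append t) X) ≡ map (append t) (raiseAll P X) × OfLength L (raiseAll P X)
  go [] [] = refl , len
  go ((a , b) ∷ P) ((a<L , b<L) ∷ below) with go P below
  ... | eq , lP with step a b (raiseAll P X) a<L b<L lP
  ... | eq′ , lP′ = trans (cong (raiseStep (a , b)) eq) eq′ , lP′

pairs-below : ∀ L → PairsBelow L (pairs L)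
pairs-below L = AllP.concat⁺ (AllP.map⁺ (All.map (λ {a} a<L →
  AllP.map⁺ (AllP.filter⁺ (a ℕ.<?_) (All.map (λ b<L → a<L , b<L) (AllP.all-upTo L)))) (AllP.all-upTo L)))

blockPairs : ℕ → ℕ → List (ℕ × ℕ)
blockPairs p q = pairs p ++ shiftPairs p (pairs q)

expansion-padded : ∀ u k′ w′ → raiseAll (pairs (length u)) [ (k′ , u ++ w′) ] ≡ map (_· (k′ , w′)) (expansion u)
expansion-padded u k′ w′ = begin
  raiseAll (pairs (length u)) [ (k′ , u ++ w′) ]
    ≡⟨ cong (λ k → raiseAll (pairs (length u)) [ (k , u ++ w′) ]) (ℕP.+-identityʳ k′) ⟨
  raiseAll (pairs (length u)) (map (shiftExp k′) [ (0 , u ++ w′) ]) ≡⟨ raiseAll-shiftExp k′ (pairs (length u)) _ ⟩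
  map (shiftExp k′) (raiseAll (pairs (length u)) (map (append w′) [ (0 , u) ]))
    ≡⟨ cong (map (shiftExp k′)) (raiseAll-append (length u) w′ (pairs (length u)) _ (pairs-below (length u)) (refl ∷ [])) ⟩
  map (shiftExp k′) (map (append w′) (expansion u))                 ≡⟨ LP.map-∘ (expansion u) ⟨
  map (shiftExp k′ ∘ append w′) (expansion u)
    ≡⟨ LP.map-cong (λ { (k , w) → cong (_, w ++ w′) (ℕP.+-comm k′ k) }) (expansion u) ⟩
  map (_· (k′ , w′)) (expansion u)                                  ∎
  where open ≡-Reasoning

expansion-⊗ : ∀ u u′ → expansion u ⊗ expansion u′ ↭ raiseAll (blockPairs (length u) (length u′)) [ (0 , u ++ u′) ]
expansion-⊗ u u′ = begin
  X ⊗ Y                                                        ≡⟨ LP.concatMap-cong (λ p → sym (concatMap-[ p ·_ ] Y)) X ⟩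
  concatMap (λ p → concatMap (λ p′ → [ p · p′ ]) Y) X           ↭⟨ concatMap-comm (λ p p′ → [ p · p′ ]) X Y ⟩
  concatMap (λ p′ → concatMap (λ p → [ p · p′ ]) X) Y
    ≡⟨ LP.concatMap-cong (λ { (k′ , w′) → trans (expansion-padded u k′ w′) (sym (concatMap-[ _· (k′ , w′) ] X)) }) Y ⟨
  concatMap (λ p′ → raiseAll Pu [ prepend u p′ ]) Y             ≡⟨ raiseAll-concatMap Pu _ Y ⟨
  raiseAll Pu (concatMap (λ p′ → [ prepend u p′ ]) Y)           ≡⟨ cong (raiseAll Pu) (concatMap-[ prepend u ] Y) ⟩
  raiseAll Pu (map (prepend u) Y)                               ≡⟨ cong (raiseAll Pu) (raiseAll-prepend u (pairs (length u′)) _) ⟨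
  raiseAll Pu (raiseAll (shiftPairs (length u) (pairs (length u′))) [ (0 , u ++ u′) ])
    ≡⟨ raiseAll-++ˡ Pu _ _ ⟨
  raiseAll (blockPairs (length u) (length u′)) [ (0 , u ++ u′) ] ∎
  where
  open ↭.PermutationReasoning
  X = expansion u
  Y = expansion u′
  Pu = pairs (length u)

mul-pow-negT-Bv-Bv : ∀ k α β f →
  mul (pow negT k) (Bv α (Bv β f)) ↭ eval (raiseAll (blockPairs (length α) (length β)) [ (k , α ++ β) ]) f
mul-pow-negT-Bv-Bv k α β f = begin
  mul (pow negT k) (Bv α (Bv β f))                         ≡⟨ mul-pow-negT k _ ⟩
  map (timesNegT k) (Bv α (Bv β f))                        ≡⟨ cong (map (timesNegT k)) (trans (Bv-eval α _) (cong (eval Xα) (Bv-eval β f))) ⟩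
  map (timesNegT k) (eval Xα (eval Xβ f))                  ↭⟨ ↭P.map⁺ (timesNegT k) (eval-⊗ Xα Xβ f) ⟩
  map (timesNegT k) (eval (Xα ⊗ Xβ) f)                     ≡⟨ map-timesNegT-eval k (Xα ⊗ Xβ) f ⟩
  eval (map (shiftExp k) (Xα ⊗ Xβ)) f                      ↭⟨ eval⁺ f (↭P.map⁺ (shiftExp k) (expansion-⊗ α β)) ⟩
  eval (map (shiftExp k) (raiseAll P [ (0 , α ++ β) ])) f  ≡⟨ cong (λ X → eval X f) (raiseAll-shiftExp k P _) ⟨
  eval (raiseAll P [ (k + 0 , α ++ β) ]) f                 ≡⟨ cong (λ j → eval (raiseAll P [ (j , α ++ β) ]) f) (ℕP.+-identityʳ k) ⟩
  eval (raiseAll P [ (k , α ++ β) ]) f                     ∎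
  where
  open ↭.PermutationReasoning
  Xα = expansion α
  Xβ = expansion β
  P = blockPairs (length α) (length β)

length-zipWith : {A B C : Set} (f : A → B → C) (a : List A) (b : List B) {k : ℕ} →
                 length a ≡ k → length b ≡ k → length (zipWith f a b) ≡ k
length-zipWith f a b refl lb = trans (LP.length-zipWith f a b) (trans (cong (length a ℕ.⊓_) lb) (ℕP.⊓-idem _))

length-toZ : ∀ xs → length (toZ xs) ≡ length xs
length-toZ xs = LP.length-map _ xs

length-⊕ : ∀ g I {k} → length g ≡ k → length I ≡ k → length (g ⊕ toZ I) ≡ k
length-⊕ g I lg lI = length-zipWith ℤ._+_ g (toZ I) lg (trans (length-toZ I) lI)

length-⊖ : ∀ u E {k} → length u ≡ k → length E ≡ k → length (u ⊖ toZ E) ≡ k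
length-⊖ u E lu lE = length-zipWith ℤ._-_ u (toZ E) lu (trans (length-toZ E) lE)

⊖-zipWith-+ : ∀ u a b → u ⊖ toZ (zipWith _+_ a b) ≡ (u ⊖ toZ b) ⊖ toZ a
⊖-zipWith-+ [] a b = refl
⊖-zipWith-+ (x ∷ u) [] [] = refl
⊖-zipWith-+ (x ∷ u) [] (b₀ ∷ b) = refl
⊖-zipWith-+ (x ∷ u) (a₀ ∷ a) [] = refl
⊖-zipWith-+ (x ∷ u) (a₀ ∷ a) (b₀ ∷ b) = cong₂ _∷_ head (⊖-zipWith-+ u a b)
  where
  head : x ℤ.- + (a₀ + b₀) ≡ (x ℤ.- + b₀) ℤ.- + a₀
  head = begin
    x ℤ.+ ℤ.- + (a₀ + b₀)                ≡⟨ cong (λ z → x ℤ.+ ℤ.- z) (ℤP.pos-+ a₀ b₀) ⟩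
    x ℤ.+ ℤ.- (+ a₀ ℤ.+ + b₀)            ≡⟨ cong (λ z → x ℤ.+ z) (ℤP.neg-distrib-+ (+ a₀) (+ b₀)) ⟩
    x ℤ.+ (ℤ.- + a₀ ℤ.+ ℤ.- + b₀)        ≡⟨ ℤP.+-assoc x (ℤ.- + a₀) (ℤ.- + b₀) ⟨
    (x ℤ.+ ℤ.- + a₀) ℤ.+ ℤ.- + b₀        ≡⟨ +-right-comm x (ℤ.- + a₀) (ℤ.- + b₀) ⟩
    (x ℤ.+ ℤ.- + b₀) ℤ.+ ℤ.- + a₀        ∎
    where open ≡-Reasoning

⊖-replicate-0 : ∀ u → u ⊖ toZ (replicate (length u) 0) ≡ u
⊖-replicate-0 [] = refl
⊖-replicate-0 (x ∷ u) = cong₂ _∷_ (ℤP.+-identityʳ x) (⊖-replicate-0 u)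

length-vecs : ∀ m n → All (λ I → length I ≡ m) (vecs m n)
length-vecs zero n = refl ∷ []
length-vecs (suc m) n = AllP.concat⁺ (AllP.map⁺ (AllP.applyUpTo⁺₂ id (suc n) (λ i → AllP.map⁺ (All.map (cong suc) (length-vecs m n)))))

length-bins : ∀ n → All (λ E → length E ≡ n) (bins n)
length-bins zero = refl ∷ []
length-bins (suc n) = AllP.++⁺ (AllP.map⁺ (All.map (cong suc) (length-bins n))) (AllP.++⁺ (AllP.map⁺ (All.map (cong suc) (length-bins n))) [])

sum-bins : ∀ n → All (λ E → sum E < suc n) (bins n)
sum-bins zero = s≤s z≤n ∷ []
sum-bins (suc n) = AllP.++⁺ (AllP.map⁺ (All.map ℕP.m≤n⇒m≤1+n (sum-bins n))) (AllP.++⁺ (AllP.map⁺ (All.map s≤s (sum-bins n))) [])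

length-sumE-EI : ∀ I n → All (λ Es → length (sumE n Es) ≡ n) (EI I n)
length-sumE-EI [] n = LP.length-replicate n ∷ []
length-sumE-EI (i ∷ I) n = AllP.concat⁺ (AllP.map⁺ (All.map
  (λ {E} lE → AllP.map⁺ (All.map (λ {Es} → length-zipWith _+_ E (sumE n Es) lE) (length-sumE-EI I n)))
                                                          (AllP.filter⁺ (λ E → sum E ℕ.≟ i) (length-bins n))))

module _ {A : Set} (κ : A → ℕ) where

  private
    withKey : ℕ → List A → List A
    withKey i = filter (λ x → κ x ℕ.≟ i)

  groupByKey-single : ∀ N x → κ x < N → concatMap (λ i → withKey i [ x ]) (upTo N) ≡ [ x ]
  groupByKey-single (suc N) x κx<1+N = begin
    concatMap F (upTo (suc N))         ≡⟨ cong (concatMap F) (LP.upTo-∷ʳ N) ⟨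
    concatMap F (upTo N ++ [ N ])      ≡⟨ LP.concatMap-++ F (upTo N) [ N ] ⟩
    concatMap F (upTo N) ++ F N ++ []  ≡⟨ split (ℕP.m≤n⇒m<n∨m≡n (ℕP.≤-pred κx<1+N)) ⟩
    [ x ]                              ∎
    where
    open ≡-Reasoning
    F : ℕ → List A
    F i = withKey i [ x ]
    split : κ x < N ⊎ κ x ≡ N → concatMap F (upTo N) ++ F N ++ [] ≡ [ x ]
    split (inj₁ κx<N) = cong₂ _++_ (groupByKey-single N x κx<N) (cong (_++ []) (LP.filter-reject (λ y → κ y ℕ.≟ N) (ℕP.<⇒≢ κx<N)))
    split (inj₂ κx≡N) = cong₂ _++_
      (trans (concatMap-cong-local (All.map (λ i<N → LP.filter-reject (λ y → κ y ℕ.≟ _) (λ κx≡i → ℕP.<⇒≢ i<N (trans (sym κx≡i) κx≡N)))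
                                            (AllP.all-upTo N)))
             (concatMap-[] (upTo N)))
      (cong (_++ []) (LP.filter-accept (λ y → κ y ℕ.≟ N) κx≡N))

  groupByKey : ∀ N xs → All (λ x → κ x < N) xs → concatMap (λ i → withKey i xs) (upTo N) ↭ xs
  groupByKey N [] [] = ↭-reflexive (concatMap-[] (upTo N))
  groupByKey N (x ∷ xs) (κx<N ∷ κxs<N) = begin
    concatMap (λ i → withKey i ([ x ] ++ xs)) (upTo N)
      ≡⟨ LP.concatMap-cong (λ i → LP.filter-++ (λ y → κ y ℕ.≟ i) [ x ] xs) (upTo N) ⟩
    concatMap (λ i → withKey i [ x ] ++ withKey i xs) (upTo N)       ↭⟨ concatMap-++-distrib _ _ (upTo N) ⟩
    concatMap (λ i → withKey i [ x ]) (upTo N) ++ concatMap (λ i → withKey i xs) (upTo N)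
      ≡⟨ cong (_++ _) (groupByKey-single N x κx<N) ⟩
    x ∷ concatMap (λ i → withKey i xs) (upTo N)                     <⟨ groupByKey N xs κxs<N ⟩
    x ∷ xs                                                          ∎
    where open ↭.PermutationReasoning

groupByWeight : {B : Set} (n : ℕ) (G : ℕ → List ℕ → List B) →
                concatMap (λ i → concatMap (G i) (Ed i n)) (upTo (suc n)) ↭ concatMap (λ E → G (sum E) E) (bins n)
groupByWeight n G = begin
  concatMap (λ i → concatMap (G i) (Ed i n)) (upTo (suc n))
    ≡⟨ LP.concatMap-cong (λ i → concatMap-cong-local (All.map (λ sumE≡i → cong (λ j → G j _) (sym sumE≡i))
                                                             (AllP.all-filter (λ E → sum E ℕ.≟ i) (bins n)))) (upTo (suc n)) ⟩
  concatMap (λ i → concatMap (λ E → G (sum E) E) (Ed i n)) (upTo (suc n))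
    ≡⟨ concatMap-concatMap (λ E → G (sum E) E) (λ i → Ed i n) (upTo (suc n)) ⟨
  concatMap (λ E → G (sum E) E) (concatMap (λ i → Ed i n) (upTo (suc n)))
    ↭⟨ concatMap⁺ (λ E → G (sum E) E) (groupByKey sum (suc n) (bins n) (sum-bins n)) ⟩
  concatMap (λ E → G (sum E) E) (bins n) ∎
  where open ↭.PermutationReasoning

crossPairs : ℕ → ℕ → List (ℕ × ℕ)
crossPairs m n = concatMap (λ a → map (λ b → (a , m + b)) (upTo n)) (upTo m)

rowPairs : ℕ → ℕ → List (ℕ × ℕ)
rowPairs c n = map (λ b → (0 , suc c + b)) (upTo n)

upTo-suc : ∀ m → upTo (suc m) ≡ 0 ∷ map suc (upTo m)
upTo-suc m = cong (0 ∷_) (sym (LP.map-applyUpTo id suc m))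

rowPairs-suc : ∀ c n → rowPairs c (suc n) ≡ (0 , suc c + 0) ∷ rowPairs (suc c) n
rowPairs-suc c n = trans (cong (map (λ b → (0 , suc c + b))) (upTo-suc n))
  (cong (_ ∷_) (trans (sym (LP.map-∘ (upTo n))) (LP.map-cong (λ b → cong (λ j → (0 , suc j)) (ℕP.+-suc c b)) (upTo n))))

crossPairs-suc : ∀ m n → crossPairs (suc m) n ≡ rowPairs m n ++ shiftPairs 1 (crossPairs m n)
crossPairs-suc m n = trans (cong (concatMap row) (upTo-suc m)) (cong (rowPairs m n ++_) (begin
  concatMap row (map suc (upTo m))                        ≡⟨ LP.concatMap-map row suc (upTo m) ⟩
  concatMap (λ a → map (shift ∘ (λ b → (a , m + b))) (upTo n)) (upTo m) ≡⟨ LP.concatMap-cong (λ a → LP.map-∘ (upTo n)) (upTo m) ⟩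
  concatMap (λ a → map shift (map (λ b → (a , m + b)) (upTo n))) (upTo m) ≡⟨ LP.map-concatMap shift _ (upTo m) ⟨
  shiftPairs 1 (crossPairs m n)                           ∎))
  where
  open ≡-Reasoning
  row : ℕ → List (ℕ × ℕ)
  row a = map (λ b → (a , suc m + b)) (upTo n)
  shift : ℕ × ℕ → ℕ × ℕ
  shift (a , b) = (1 + a , 1 + b)

rowWord : ℤ → List ℤ → List ℤ → List ℤ → ℕ → List ℕ → Word
rowWord g₀ z u t k E = (sum E + k , (g₀ ℤ.+ + sum E) ∷ (z ++ ((u ⊖ toZ E) ++ t)))

raiseStep-map : ∀ a b (F : List ℕ → Word) Es →
  raiseStep (a , b) (map F Es) ↭ map F Es ++ map (λ E → (suc (proj₁ (F E)) , raise a b (proj₂ (F E)))) Es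
raiseStep-map a b F Es = begin
  raiseStep (a , b) (map F Es)                   ≡⟨ LP.concatMap-map _ F Es ⟩
  concatMap (λ E → [ F E ] ++ [ G E ]) Es         ↭⟨ concatMap-++-distrib (λ E → [ F E ]) (λ E → [ G E ]) Es ⟩
  concatMap (λ E → [ F E ]) Es ++ concatMap (λ E → [ G E ]) Es ≡⟨ cong₂ _++_ (concatMap-[ F ] Es) (concatMap-[ G ] Es) ⟩
  map F Es ++ map G Es                           ∎
  where
  open ↭.PermutationReasoning
  G : List ℕ → Word
  G E = (suc (proj₁ (F E)) , raise a b (proj₂ (F E)))

-- The raising operators of one γ-entry against the entries of u expand to a sum over the 0/1-vectors E.
raiseAll-rowPairs : ∀ n z g₀ u t k → length u ≡ n →
  raiseAll (rowPairs (length z) n) [ (k , g₀ ∷ (z ++ (u ++ t))) ] ↭ map (rowWord g₀ z u t k) (bins n)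
raiseAll-rowPairs zero z g₀ [] t k refl = ↭-reflexive (cong (λ x → [ (k , x ∷ (z ++ t)) ]) (sym (ℤP.+-identityʳ g₀)))
raiseAll-rowPairs (suc n) z g₀ (u₀ ∷ u) t k len = begin
  raiseAll (rowPairs (length z) (suc n)) [ (k , g₀ ∷ (z ++ (u₀ ∷ u ++ t))) ]
    ≡⟨ cong (λ P → raiseAll P [ (k , g₀ ∷ (z ++ (u₀ ∷ u ++ t))) ]) (rowPairs-suc (length z) n) ⟩
  raiseStep (0 , suc (length z) + 0) (raiseAll (rowPairs (suc (length z)) n) [ (k , g₀ ∷ (z ++ (u₀ ∷ u ++ t))) ])
    ≡⟨ cong₂ (λ c w → raiseStep (0 , suc (length z) + 0) (raiseAll (rowPairs c n) [ (k , g₀ ∷ w) ]))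
             length-z′ (LP.++-assoc z [ u₀ ] (u ++ t)) ⟨
  raiseStep (0 , suc (length z) + 0) (raiseAll (rowPairs (length z′) n) [ (k , g₀ ∷ (z′ ++ (u ++ t))) ])
    ↭⟨ concatMap⁺ _ (raiseAll-rowPairs n z′ g₀ u t k (ℕP.suc-injective len)) ⟩
  raiseStep (0 , suc (length z) + 0) (map (rowWord g₀ z′ u t k) (bins n))
    ↭⟨ raiseStep-map 0 (suc (length z) + 0) (rowWord g₀ z′ u t k) (bins n) ⟩
  map (rowWord g₀ z′ u t k) (bins n) ++ map raisedWord (bins n)
    ≡⟨ cong₂ _++_ (LP.map-cong (λ E → sym (unraised E)) (bins n)) (LP.map-cong (λ E → sym (raised E)) (bins n)) ⟩
  map (F ∘ (0 ∷_)) (bins n) ++ map (F ∘ (1 ∷_)) (bins n)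
    ≡⟨ cong₂ _++_ (LP.map-∘ (bins n)) (trans (LP.map-∘ (bins n)) (cong (map F) (sym (LP.++-identityʳ _)))) ⟩
  map F (map (0 ∷_) (bins n)) ++ map F (map (1 ∷_) (bins n) ++ [])
    ≡⟨ LP.map-++ F (map (0 ∷_) (bins n)) _ ⟨
  map F (bins (suc n)) ∎
  where
  open ↭.PermutationReasoning
  z′ = z ++ [ u₀ ]
  length-z′ : length z′ ≡ suc (length z)
  length-z′ = trans (LP.length-++ z) (ℕP.+-comm (length z) 1)
  F = rowWord g₀ z (u₀ ∷ u) t k
  raisedWord : List ℕ → Word
  raisedWord E = (suc (proj₁ (rowWord g₀ z′ u t k E)) , raise 0 (suc (length z) + 0) (proj₂ (rowWord g₀ z′ u t k E)))
  unraised : ∀ E → F (0 ∷ E) ≡ rowWord g₀ z′ u t k E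
  unraised E = cong (λ w → (sum E + k , (g₀ ℤ.+ + sum E) ∷ w))
    (trans (cong (λ x → z ++ (x ∷ ((u ⊖ toZ E) ++ t))) (ℤP.+-identityʳ u₀)) (sym (LP.++-assoc z [ u₀ ] _)))
  raised : ∀ E → F (1 ∷ E) ≡ raisedWord E
  raised E = cong₂ (λ x w → (suc (sum E + k) , x ∷ w))
    (trans (cong (λ j → g₀ ℤ.+ + j) (ℕP.+-comm 1 (sum E))) (sym (ℤP.+-assoc g₀ (+ sum E) (+ 1))))
    (sym (trans (cong (modifyAt (length z + 0) dec) (LP.++-assoc z [ u₀ ] ((u ⊖ toZ E) ++ t)))
                (modifyAt-prepend z 0 dec (u₀ ∷ ((u ⊖ toZ E) ++ t)))))

-- the double sum over I and E on the left side, as a formal sum acting on the index vector (g , u , t)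
crossSum : ℕ → ℕ → List ℤ → List ℤ → List ℤ → List Word
crossSum m n g u t =
  concatMap (λ I → concatMap (λ Es → [ (sum I , (g ⊕ toZ I) ++ ((u ⊖ toZ (sumE n Es)) ++ t)) ]) (EI I n)) (vecs m n)

module CrossSumStep (n : ℕ) (g₀ : ℤ) (g u t : List ℤ) where

  -- the summand of crossSum (suc m) for I = i ∷ I′ and Es = E₀ ∷ Es′
  summand : ℕ → List ℕ → List ℕ → List (List ℕ) → List Word
  summand i I E₀ Es = [ (i + sum I , (g₀ ℤ.+ + i) ∷ ((g ⊕ toZ I) ++ (((u ⊖ toZ (sumE n Es)) ⊖ toZ E₀) ++ t))) ]

  crossSum-suc : ∀ m → crossSum (suc m) n (g₀ ∷ g) u t ≡
    concatMap (λ i → concatMap (λ I → concatMap (λ E₀ → concatMap (summand i I E₀) (EI I n)) (Ed i n)) (vecs m n)) (upTo (suc n))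
  crossSum-suc m = trans (concatMap-concatMap _ (λ i → map (i ∷_) (vecs m n)) (upTo (suc n)))
    (LP.concatMap-cong (λ i → trans (LP.concatMap-map _ (i ∷_) (vecs m n)) (LP.concatMap-cong (split-I i) (vecs m n))) (upTo (suc n)))
    where
    split-I : ∀ i I → concatMap (λ Es → [ (sum (i ∷ I) , ((g₀ ∷ g) ⊕ toZ (i ∷ I)) ++ ((u ⊖ toZ (sumE n Es)) ++ t)) ]) (EI (i ∷ I) n)
                    ≡ concatMap (λ E₀ → concatMap (summand i I E₀) (EI I n)) (Ed i n)
    split-I i I = trans (concatMap-concatMap _ (λ E₀ → map (E₀ ∷_) (EI I n)) (Ed i n))
      (LP.concatMap-cong (λ E₀ → trans (LP.concatMap-map _ (E₀ ∷_) (EI I n))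
        (LP.concatMap-cong (λ Es → cong (λ w → [ (i + sum I , (g₀ ℤ.+ + i) ∷ ((g ⊕ toZ I) ++ (w ++ t))) ])
                                        (⊖-zipWith-+ u E₀ (sumE n Es))) (EI I n))) (Ed i n))

  reorder : ∀ m →
    concatMap (λ i → concatMap (λ I → concatMap (λ E₀ → concatMap (summand i I E₀) (EI I n)) (Ed i n)) (vecs m n)) (upTo (suc n)) ↭
    concatMap (λ I → concatMap (λ Es → concatMap (λ i → concatMap (λ E₀ → summand i I E₀ Es) (Ed i n)) (upTo (suc n))) (EI I n)) (vecs m n)
  reorder m =
    ↭-trans (concatMap-comm (λ i I → concatMap (λ E₀ → concatMap (summand i I E₀) (EI I n)) (Ed i n)) (upTo (suc n)) (vecs m n))
    (concatMap-cong-↭ (vecs m n) (λ I →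
      ↭-trans (concatMap-cong-↭ (upTo (suc n)) (λ i → concatMap-comm (λ E₀ → summand i I E₀) (Ed i n) (EI I n)))
              (concatMap-comm (λ i Es → concatMap (λ E₀ → summand i I E₀ Es) (Ed i n)) (upTo (suc n)) (EI I n))))

  -- After grouping E₀ by weight, the sum over (i , E₀) is the expansion of the first row of raising operators.
  summands-raiseAll : ∀ m I Es → length g ≡ m → length I ≡ m → length u ≡ n → length (sumE n Es) ≡ n →
    concatMap (λ i → concatMap (λ E₀ → summand i I E₀ Es) (Ed i n)) (upTo (suc n)) ↭
    raiseAll (rowPairs m n) [ (sum I , g₀ ∷ ((g ⊕ toZ I) ++ ((u ⊖ toZ (sumE n Es)) ++ t))) ]
  summands-raiseAll m I Es lg lI lu lEs = begin
    concatMap (λ i → concatMap (λ E₀ → summand i I E₀ Es) (Ed i n)) (upTo (suc n))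
      ↭⟨ groupByWeight n (λ i E₀ → summand i I E₀ Es) ⟩
    concatMap (λ E₀ → [ rowWord g₀ z u′ t (sum I) E₀ ]) (bins n)
      ≡⟨ concatMap-[ rowWord g₀ z u′ t (sum I) ] (bins n) ⟩
    map (rowWord g₀ z u′ t (sum I)) (bins n)
      ↭⟨ raiseAll-rowPairs n z g₀ u′ t (sum I) (length-⊖ u (sumE n Es) lu lEs) ⟨
    raiseAll (rowPairs (length z) n) [ (sum I , g₀ ∷ (z ++ (u′ ++ t))) ]
      ≡⟨ cong (λ c → raiseAll (rowPairs c n) [ (sum I , g₀ ∷ (z ++ (u′ ++ t))) ]) (length-⊕ g I lg lI) ⟩
    raiseAll (rowPairs m n) [ (sum I , g₀ ∷ (z ++ (u′ ++ t))) ] ∎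
    where
    open ↭.PermutationReasoning
    z = g ⊕ toZ I
    u′ = u ⊖ toZ (sumE n Es)

concatMap₂-natural : {A B C D : Set} (h : List C → List D) →
  (∀ {X : Set} (φ : X → List C) xs → h (concatMap φ xs) ≡ concatMap (h ∘ φ) xs) →
  (As : List A) (Bs : A → List B) (F : A → B → List C) →
  h (concatMap (λ a → concatMap (F a) (Bs a)) As) ≡ concatMap (λ a → concatMap (λ b → h (F a b)) (Bs a)) As
concatMap₂-natural h h-concatMap As Bs F = trans (h-concatMap _ As) (LP.concatMap-cong (λ a → h-concatMap (F a) (Bs a)) As)

crossSum-raiseAll : ∀ m n g u t → length g ≡ m → length u ≡ n →
                    crossSum m n g u t ↭ raiseAll (crossPairs m n) [ (0 , g ++ (u ++ t)) ]
crossSum-raiseAll zero n [] u t refl refl = ↭-reflexive (cong (λ w → [ (0 , w ++ t) ]) (⊖-replicate-0 u))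
crossSum-raiseAll (suc m) n (g₀ ∷ g) u t lg lu = begin
  crossSum (suc m) n (g₀ ∷ g) u t
    ≡⟨ crossSum-suc m ⟩
  concatMap (λ i → concatMap (λ I → concatMap (λ E₀ → concatMap (summand i I E₀) (EI I n)) (Ed i n)) (vecs m n)) (upTo (suc n))
    ↭⟨ reorder m ⟩
  concatMap (λ I → concatMap (λ Es → concatMap (λ i → concatMap (λ E₀ → summand i I E₀ Es) (Ed i n)) (upTo (suc n))) (EI I n)) (vecs m n)
    ↭⟨ concatMap-cong-↭-local (All.map (λ {I} lI → concatMap-cong-↭-local (All.map (λ {Es} lEs →
         summands-raiseAll m I Es lg′ lI lu lEs) (length-sumE-EI I n))) (length-vecs m n)) ⟩
  concatMap (λ I → concatMap (λ Es → raiseAll R [ prepend [ g₀ ] (word I Es) ]) (EI I n)) (vecs m n)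
    ≡⟨ concatMap₂-natural (raiseAll R) (raiseAll-concatMap R) (vecs m n) (λ I → EI I n) (λ I Es → [ prepend [ g₀ ] (word I Es) ]) ⟨
  raiseAll R (concatMap (λ I → concatMap (λ Es → [ prepend [ g₀ ] (word I Es) ]) (EI I n)) (vecs m n))
    ≡⟨ cong (raiseAll R) (concatMap₂-natural (map (prepend [ g₀ ])) (LP.map-concatMap _) (vecs m n) (λ I → EI I n) (λ I Es → [ word I Es ])) ⟨
  raiseAll R (map (prepend [ g₀ ]) (crossSum m n g u t))
    ↭⟨ raiseAll⁺ R (↭P.map⁺ (prepend [ g₀ ]) (crossSum-raiseAll m n g u t lg′ lu)) ⟩
  raiseAll R (map (prepend [ g₀ ]) (raiseAll (crossPairs m n) [ (0 , g ++ (u ++ t)) ]))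
    ≡⟨ cong (raiseAll R) (raiseAll-prepend [ g₀ ] (crossPairs m n) _) ⟨
  raiseAll R (raiseAll (shiftPairs 1 (crossPairs m n)) [ (0 , g₀ ∷ g ++ (u ++ t)) ])
    ≡⟨ raiseAll-++ˡ R _ _ ⟨
  raiseAll (R ++ shiftPairs 1 (crossPairs m n)) [ (0 , g₀ ∷ g ++ (u ++ t)) ]
    ≡⟨ cong (λ P → raiseAll P [ (0 , g₀ ∷ g ++ (u ++ t)) ]) (crossPairs-suc m n) ⟨
  raiseAll (crossPairs (suc m) n) [ (0 , g₀ ∷ g ++ (u ++ t)) ] ∎
  where
  open ↭.PermutationReasoning
  open CrossSumStep n g₀ g u t
  lg′ = ℕP.suc-injective lg
  R = rowPairs m n
  word : List ℕ → List (List ℕ) → Word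
  word I Es = (sum I , (g ⊕ toZ I) ++ ((u ⊖ toZ (sumE n Es)) ++ t))

upTo-+ : ∀ p q → upTo (p + q) ≡ upTo p ++ map (p ℕ.+_) (upTo q)
upTo-+ zero q = sym (LP.map-id (upTo q))
upTo-+ (suc p) q = cong (0 ∷_) (begin
  applyUpTo suc (p + q)                               ≡⟨ LP.map-applyUpTo id suc (p + q) ⟨
  map suc (upTo (p + q))                              ≡⟨ cong (map suc) (upTo-+ p q) ⟩
  map suc (upTo p ++ map (p ℕ.+_) (upTo q))             ≡⟨ LP.map-++ suc (upTo p) _ ⟩
  map suc (upTo p) ++ map suc (map (p ℕ.+_) (upTo q))   ≡⟨ cong (map suc (upTo p) ++_) (LP.map-∘ (upTo q)) ⟨
  map suc (upTo p) ++ map (suc p ℕ.+_) (upTo q)         ≡⟨ cong (_++ map (suc p ℕ.+_) (upTo q)) (LP.map-applyUpTo id suc p) ⟩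
  applyUpTo suc p ++ map (suc p ℕ.+_) (upTo q)         ∎)
  where open ≡-Reasoning

filter-<-map-+ : ∀ p a xs → filter ((p + a) ℕ.<?_) (map (p ℕ.+_) xs) ≡ map (p ℕ.+_) (filter (a ℕ.<?_) xs)
filter-<-map-+ p a [] = refl
filter-<-map-+ p a (x ∷ xs) with a ℕ.<? x
... | yes a<x = trans (LP.filter-accept ((p + a) ℕ.<?_) (ℕP.+-monoʳ-< p a<x))
                (trans (cong (p + x ∷_) (filter-<-map-+ p a xs)) (cong (map (p ℕ.+_)) (sym (LP.filter-accept (a ℕ.<?_) a<x))))
... | no a≮x = trans (LP.filter-reject ((p + a) ℕ.<?_) (a≮x ∘ ℕP.+-cancelˡ-< p a x))
                (trans (filter-<-map-+ p a xs) (cong (map (p ℕ.+_)) (sym (LP.filter-reject (a ℕ.<?_) a≮x))))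

pairsRow : ℕ → ℕ → List (ℕ × ℕ)
pairsRow L a = map (a ,_) (filter (a ℕ.<?_) (upTo L))

pairsRow-+ˡ : ∀ p q {a} → a < p → pairsRow (p + q) a ≡ pairsRow p a ++ map (λ b → (a , p + b)) (upTo q)
pairsRow-+ˡ p q {a} a<p = begin
  map (a ,_) (filter (a ℕ.<?_) (upTo (p + q)))
    ≡⟨ cong (map (a ,_)) (trans (cong (filter (a ℕ.<?_)) (upTo-+ p q)) (LP.filter-++ (a ℕ.<?_) (upTo p) _)) ⟩
  map (a ,_) (filter (a ℕ.<?_) (upTo p) ++ filter (a ℕ.<?_) (map (p ℕ.+_) (upTo q)))
    ≡⟨ LP.map-++ (a ,_) (filter (a ℕ.<?_) (upTo p)) _ ⟩
  pairsRow p a ++ map (a ,_) (filter (a ℕ.<?_) (map (p ℕ.+_) (upTo q)))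
    ≡⟨ cong (λ xs → pairsRow p a ++ map (a ,_) xs)
            (LP.filter-all (a ℕ.<?_) (AllP.map⁺ (AllP.applyUpTo⁺₂ id q (λ b → ℕP.<-≤-trans a<p (ℕP.m≤m+n p b))))) ⟩
  pairsRow p a ++ map (a ,_) (map (p ℕ.+_) (upTo q))
    ≡⟨ cong (pairsRow p a ++_) (LP.map-∘ (upTo q)) ⟨
  pairsRow p a ++ map (λ b → (a , p + b)) (upTo q) ∎
  where open ≡-Reasoning

pairsRow-+ʳ : ∀ p q a → pairsRow (p + q) (p + a) ≡ shiftPairs p (pairsRow q a)
pairsRow-+ʳ p q a = begin
  map (p + a ,_) (filter (p + a ℕ.<?_) (upTo (p + q)))
    ≡⟨ cong (map (p + a ,_)) (trans (cong (filter (p + a ℕ.<?_)) (upTo-+ p q)) (LP.filter-++ (p + a ℕ.<?_) (upTo p) _)) ⟩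
  map (p + a ,_) (filter (p + a ℕ.<?_) (upTo p) ++ filter (p + a ℕ.<?_) (map (p ℕ.+_) (upTo q)))
    ≡⟨ cong₂ (λ xs ys → map (p + a ,_) (xs ++ ys))
             (LP.filter-none (p + a ℕ.<?_) (All.map (λ b<p p+a<b → ℕP.<-asym b<p (ℕP.≤-<-trans (ℕP.m≤m+n p a) p+a<b)) (AllP.all-upTo p)))
             (filter-<-map-+ p a (upTo q)) ⟩
  map (p + a ,_) (map (p ℕ.+_) (filter (a ℕ.<?_) (upTo q)))
    ≡⟨ trans (sym (LP.map-∘ (filter (a ℕ.<?_) (upTo q)))) (LP.map-∘ (filter (a ℕ.<?_) (upTo q))) ⟩
  shiftPairs p (pairsRow q a) ∎
  where open ≡-Reasoning

pairs-+ : ∀ p q → pairs (p + q) ↭ pairs p ++ crossPairs p q ++ shiftPairs p (pairs q)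
pairs-+ p q = begin
  concatMap (pairsRow (p + q)) (upTo (p + q))
    ≡⟨ trans (cong (concatMap (pairsRow (p + q))) (upTo-+ p q)) (LP.concatMap-++ (pairsRow (p + q)) (upTo p) _) ⟩
  concatMap (pairsRow (p + q)) (upTo p) ++ concatMap (pairsRow (p + q)) (map (p ℕ.+_) (upTo q))
    ≡⟨ cong₂ _++_ (concatMap-cong-local (All.map (pairsRow-+ˡ p q) (AllP.all-upTo p)))
                  (trans (LP.concatMap-map (pairsRow (p + q)) (p ℕ.+_) (upTo q)) (LP.concatMap-cong (pairsRow-+ʳ p q) (upTo q))) ⟩
  concatMap (λ a → pairsRow p a ++ cross a) (upTo p) ++ concatMap (shiftPairs p ∘ pairsRow q) (upTo q)
    ↭⟨ ↭P.++⁺ʳ _ (concatMap-++-distrib (pairsRow p) cross (upTo p)) ⟩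
  (pairs p ++ crossPairs p q) ++ concatMap (shiftPairs p ∘ pairsRow q) (upTo q)
    ≡⟨ cong ((pairs p ++ crossPairs p q) ++_) (LP.map-concatMap (λ { (a , b) → (p + a , p + b) }) (pairsRow q) (upTo q)) ⟨
  (pairs p ++ crossPairs p q) ++ shiftPairs p (pairs q)
    ≡⟨ LP.++-assoc (pairs p) (crossPairs p q) _ ⟩
  pairs p ++ crossPairs p q ++ shiftPairs p (pairs q) ∎
  where
  open ↭.PermutationReasoning
  cross : ℕ → List (ℕ × ℕ)
  cross a = map (λ b → (a , p + b)) (upTo q)

shiftPairs-shiftPairs : ∀ r m P → shiftPairs r (shiftPairs m P) ≡ shiftPairs (r + m) P
shiftPairs-shiftPairs r m P = trans (sym (LP.map-∘ P)) (LP.map-cong (λ { (a , b) → cong₂ _,_ (sym (ℕP.+-assoc r m a)) (sym (ℕP.+-assoc r m b)) }) P)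

-- Both sides consist of all pairs of positions in (μ , γ , ν) except those in μ × ν.
blockPairs-crossPairs : ∀ r m n →
  blockPairs (r + m) n ++ shiftPairs r (crossPairs m n) ↭ blockPairs r (m + n) ++ crossPairs r m
blockPairs-crossPairs r m n = begin
  (pairs (r + m) ++ inν) ++ γν                     ↭⟨ ↭P.++⁺ʳ γν (↭P.++⁺ʳ inν (pairs-+ r m)) ⟩
  ((inμ ++ μγ ++ inγ) ++ inν) ++ γν                ↭⟨ blocks inμ μγ inγ inν γν ⟩
  (inμ ++ inγ ++ γν ++ inν) ++ μγ                  ≡⟨ cong (λ X → (inμ ++ X) ++ μγ) shifted-pairs ⟨
  (inμ ++ shiftPairs r (pairs m ++ crossPairs m n ++ shiftPairs m (pairs n))) ++ μγ
    ↭⟨ ↭P.++⁺ʳ μγ (↭P.++⁺ˡ inμ (↭P.map⁺ _ (↭-sym (pairs-+ m n)))) ⟩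
  (inμ ++ shiftPairs r (pairs (m + n))) ++ μγ      ∎
  where
  open ↭.PermutationReasoning
  inμ = pairs r
  μγ = crossPairs r m
  inγ = shiftPairs r (pairs m)
  inν = shiftPairs (r + m) (pairs n)
  γν = shiftPairs r (crossPairs m n)
  shifted-pairs : shiftPairs r (pairs m ++ crossPairs m n ++ shiftPairs m (pairs n)) ≡ inγ ++ γν ++ inν
  shifted-pairs = trans (LP.map-++ _ (pairs m) _)
    (cong (inγ ++_) (trans (LP.map-++ _ (crossPairs m n) _) (cong (γν ++_) (shiftPairs-shiftPairs r m (pairs n)))))
  blocks : ∀ a b c d e → ((a ++ b ++ c) ++ d) ++ e ↭ (a ++ c ++ e ++ d) ++ b
  blocks = ↭-solve 5 (λ a b c d e → ((a ∙ (b ∙ c)) ∙ d) ∙ e ⊜ (a ∙ (c ∙ (e ∙ d))) ∙ b) ↭-refl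
    where open import Algebra.Solver.CommutativeMonoid (↭P.++-commutativeMonoid {A = ℕ × ℕ})
            using (_⊜_) renaming (solve to ↭-solve; _⊕_ to _∙_)

doubleSum-Bv-Bv : {A B : Set} (f : Sym) (Is : List A) (Es : A → List B) (k : A → ℕ) (α : A → List ℤ) (β : B → List ℤ) {p q : ℕ} →
  All (λ I → length (α I) ≡ p) Is → (∀ I → All (λ E → length (β E) ≡ q) (Es I)) →
  concatMap (λ I → concatMap (λ E → mul (pow negT (k I)) (Bv (α I) (Bv (β E) f))) (Es I)) Is ↭
  eval (raiseAll (blockPairs p q) (concatMap (λ I → concatMap (λ E → [ (k I , α I ++ β E) ]) (Es I)) Is)) f
doubleSum-Bv-Bv f Is Es k α β {p} {q} lα lβ = begin
  concatMap (λ I → concatMap (λ E → mul (pow negT (k I)) (Bv (α I) (Bv (β E) f))) (Es I)) Is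
    ↭⟨ concatMap-cong-↭-local (All.map (λ {I} lαI → concatMap-cong-↭-local (All.map (summand lαI) (lβ I))) lα) ⟩
  concatMap (λ I → concatMap (λ E → eval (raiseAll P [ (k I , α I ++ β E) ]) f) (Es I)) Is
    ≡⟨ concatMap₂-natural (λ X → eval X f) (λ φ xs → eval-concatMap φ xs f) Is Es (λ I E → raiseAll P [ (k I , α I ++ β E) ]) ⟨
  eval (concatMap (λ I → concatMap (λ E → raiseAll P [ (k I , α I ++ β E) ]) (Es I)) Is) f
    ≡⟨ cong (λ X → eval X f) (concatMap₂-natural (raiseAll P) (raiseAll-concatMap P) Is Es (λ I E → [ (k I , α I ++ β E) ])) ⟨
  eval (raiseAll P (concatMap (λ I → concatMap (λ E → [ (k I , α I ++ β E) ]) (Es I)) Is)) f ∎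
  where
  open ↭.PermutationReasoning
  P = blockPairs p q
  summand : ∀ {I E} → length (α I) ≡ p → length (β E) ≡ q →
            mul (pow negT (k I)) (Bv (α I) (Bv (β E) f)) ↭ eval (raiseAll P [ (k I , α I ++ β E) ]) f
  summand {I} {E} refl refl = mul-pow-negT-Bv-Bv (k I) (α I) (β E) f

module _ (ν μ γ : List ℕ) (f : Sym) where

  private
    r m n : ℕ
    r = length μ
    m = length γ
    n = length ν
    V : List ℤ
    V = toZ μ ++ (toZ γ ++ toZ ν)

  LHS-raiseAll : LHS ν μ γ f ↭ eval (raiseAll (blockPairs (r + m) n) (raiseAll (shiftPairs r (crossPairs m n)) [ (0 , V) ])) f
  LHS-raiseAll = begin
    LHS ν μ γ f
      ↭⟨ doubleSum-Bv-Bv f (vecs m n) (λ I → EI I n) sum α β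
           (All.map (λ {I} lI → trans (LP.length-++ (toZ μ)) (cong₂ _+_ (length-toZ μ) (length-⊕ (toZ γ) I (length-toZ γ) lI))) (length-vecs m n))
           (λ I → All.map (λ {Es} → length-⊖ (toZ ν) (sumE n Es) (length-toZ ν)) (length-sumE-EI I n)) ⟩
    eval (raiseAll P (concatMap (λ I → concatMap (λ Es → [ (sum I , α I ++ β Es) ]) (EI I n)) (vecs m n))) f
      ≡⟨ cong (λ X → eval (raiseAll P X) f) regroup ⟩
    eval (raiseAll P (map (prepend (toZ μ)) (crossSum m n (toZ γ) (toZ ν) []))) f
      ↭⟨ eval⁺ f (raiseAll⁺ P (↭P.map⁺ (prepend (toZ μ)) (crossSum-raiseAll m n (toZ γ) (toZ ν) [] (length-toZ γ) (length-toZ ν)))) ⟩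
    eval (raiseAll P (map (prepend (toZ μ)) (raiseAll (crossPairs m n) [ (0 , toZ γ ++ (toZ ν ++ [])) ]))) f
      ≡⟨ cong (λ X → eval (raiseAll P X) f) (sym (raiseAll-prepend (toZ μ) (crossPairs m n) _)) ⟩
    eval (raiseAll P (raiseAll (shiftPairs (length (toZ μ)) (crossPairs m n)) [ (0 , toZ μ ++ (toZ γ ++ (toZ ν ++ []))) ])) f
      ≡⟨ cong₂ (λ c w → eval (raiseAll P (raiseAll (shiftPairs c (crossPairs m n)) [ (0 , toZ μ ++ (toZ γ ++ w)) ])) f)
               (length-toZ μ) (LP.++-identityʳ (toZ ν)) ⟩
    eval (raiseAll P (raiseAll (shiftPairs r (crossPairs m n)) [ (0 , V) ])) f ∎
    where
    open ↭.PermutationReasoning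
    P = blockPairs (r + m) n
    α : List ℕ → List ℤ
    α I = toZ μ ++ (toZ γ ⊕ toZ I)
    β : List (List ℕ) → List ℤ
    β Es = toZ ν ⊖ toZ (sumE n Es)
    regroup : concatMap (λ I → concatMap (λ Es → [ (sum I , α I ++ β Es) ]) (EI I n)) (vecs m n)
              ≡ map (prepend (toZ μ)) (crossSum m n (toZ γ) (toZ ν) [])
    regroup = sym (trans (concatMap₂-natural (map (prepend (toZ μ))) (LP.map-concatMap _) (vecs m n) (λ I → EI I n) _)
      (LP.concatMap-cong (λ I → LP.concatMap-cong (λ Es → cong (λ w → [ (sum I , w) ])
        (trans (cong (λ w → toZ μ ++ ((toZ γ ⊕ toZ I) ++ w)) (LP.++-identityʳ (β Es))) (sym (LP.++-assoc (toZ μ) _ (β Es))))) (EI I n)) (vecs m n)))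

  RHS-raiseAll : RHS ν μ γ f ↭ eval (raiseAll (blockPairs r (m + n)) (raiseAll (crossPairs r m) [ (0 , V) ])) f
  RHS-raiseAll = ↭-trans
    (doubleSum-Bv-Bv f (vecs r m) (λ I → EI I m) sum (λ I → toZ μ ⊕ toZ I) (λ Es → (toZ γ ⊖ toZ (sumE m Es)) ++ toZ ν)
      (All.map (λ {I} → length-⊕ (toZ μ) I (length-toZ μ)) (length-vecs r m))
      (λ I → All.map (λ {Es} lEs → trans (LP.length-++ (toZ γ ⊖ toZ (sumE m Es)))
          (cong₂ _+_ (length-⊖ (toZ γ) (sumE m Es) (length-toZ γ) lEs) (length-toZ ν)))
        (length-sumE-EI I m)))
    (eval⁺ f (raiseAll⁺ (blockPairs r (m + n)) (crossSum-raiseAll r m (toZ μ) (toZ γ) (toZ ν) (length-toZ μ) (length-toZ γ))))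

lemma4 : (ν μ γ : List ℕ) → IsPartition ν → IsPartition μ → IsPartition γ →
    (f : Sym) → LHS ν μ γ f ≈ RHS ν μ γ f
lemma4 ν μ γ _ _ _ f = ↭⇒≈ (begin
  LHS ν μ γ f                                                    ↭⟨ LHS-raiseAll ν μ γ f ⟩
  eval (raiseAll (blockPairs (r + m) n) (raiseAll (shiftPairs r (crossPairs m n)) [ w ])) f
    ≡⟨ cong (λ X → eval X f) (raiseAll-++ˡ (blockPairs (r + m) n) _ [ w ]) ⟨
  eval (raiseAll (blockPairs (r + m) n ++ shiftPairs r (crossPairs m n)) [ w ]) f
    ↭⟨ eval⁺ f (raiseAll-↭ (blockPairs-crossPairs r m n) [ w ]) ⟩
  eval (raiseAll (blockPairs r (m + n) ++ crossPairs r m) [ w ]) f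
    ≡⟨ cong (λ X → eval X f) (raiseAll-++ˡ (blockPairs r (m + n)) _ [ w ]) ⟩
  eval (raiseAll (blockPairs r (m + n)) (raiseAll (crossPairs r m) [ w ])) f ↭⟨ RHS-raiseAll ν μ γ f ⟨
  RHS ν μ γ f                                                    ∎)
  where
  open ↭.PermutationReasoning
  r = length μ
  m = length γ
  n = length ν
  w : Word
  w = (0 , toZ μ ++ (toZ γ ++ toZ ν))
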